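{- Let $n\ge1$. Let $\mathcal A$ be the set of partitions $\lambda$ in which every part occurs at most twice, whose alternating sum type (modulus $3$) satisfies $\Sigma_2(\lambda)=2$, and in which exactly two basic units $(\lambda_{3i-2},\lambda_{3i-1},\lambda_{3i})$ satisfy $\lambda_{3i-1}-\lambda_{3i}=1$. Put $$G_n=\frac{z^{n+1}q^{3n^2+4n+1}}{(zq;q^3)_{n+1}(q^3;q^3)_{n}}.$$ Then $$\sum_{\substack{\lambda\in\mathcal A\\ \lambda\text{ has exactly }3n+2\text{ positive parts}}} z^{\Sigma_1(\lambda)}q^{|\lambda|}=G_n\Bigg[\frac{q^2}{z^2}+\frac{q^3(1-q^{3n})}{z}+\sum_{d=1}^{n-1}\frac{1}{z^2q^{3n-3d-2}}\Bigg].$$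
   Context: For a partition $\lambda_1\ge\dots\ge\lambda_r>0$, append zero parts so that its length becomes a multiple $3k$ of $3$. Its basic units are the blocks $(\lambda_{3i-2},\lambda_{3i-1},\lambda_{3i})$, $1\le i\le k$, and its alternating sum type (modulus 3) is $(\Sigma_1,\Sigma_2)$ with $\Sigma_1=\sum_{i=1}^k(\lambda_{3i-2}-\lambda_{3i-1})$ and $\Sigma_2=\sum_{i=1}^k(\lambda_{3i-1}-\lambda_{3i})$. $|\lambda|$ is the sum of the parts. $(a;q)_n=\prod_{i=0}^{n-1}(1-aq^i)$, with $(a;q)_0=1$. Empty sums are zero; the identity is one of formal power series in $q$ with coefficients Laurent polynomials in $z$. -}

module Defs where

open import Data.Nat as ℕ using (ℕ; zero; suc; _≤_; _≥_; _≤?_; _≥?_)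
open import Data.Integer as ℤ using (ℤ; +_; -[1+_])
open import Data.List using (List; []; _∷_; map; length; filter; concatMap; upTo; foldr)
open import Data.Nat.ListAction using (sum)
open import Data.List.Relation.Unary.All using (All; all?)
open import Data.List.Relation.Unary.Linked using (Linked; linked?)
open import Data.Product using (_×_; _,_)
open import Data.Bool using (if_then_else_)
open import Relation.Nullary using (Dec; does)
open import Relation.Nullary.Decidable using (_×-dec_)
open import Relation.Binary.PropositionalEquality using (_≡_)

sumℤ : List ℤ → ℤ
sumℤ = foldr ℤ._+_ (+ 0)

-- Basic units: the parts are padded with zeros to a length that is a
-- multiple of 3 and cut into consecutive blocks (λ₃ᵢ₋₂, λ₃ᵢ₋₁, λ₃ᵢ).
blocks : List ℕ → List (ℕ × ℕ × ℕ)
blocks []               = []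
blocks (a ∷ [])         = (a , 0 , 0) ∷ []
blocks (a ∷ b ∷ [])     = (a , b , 0) ∷ []
blocks (a ∷ b ∷ c ∷ xs) = (a , b , c) ∷ blocks xs

Σ₁ : List ℕ → ℤ
Σ₁ xs = sumℤ (map (λ { (a , b , c) → + a ℤ.- + b }) (blocks xs))

Σ₂ : List ℕ → ℤ
Σ₂ xs = sumℤ (map (λ { (a , b , c) → + b ℤ.- + c }) (blocks xs))

unitsGap1 : List ℕ → ℕ
unitsGap1 xs = length (filter (λ { (a , b , c) → (+ b ℤ.- + c) ℤ.≟ + 1 }) (blocks xs))

occ : ℕ → List ℕ → ℕ
occ x xs = length (filter (x ℕ.≟_) xs)

IsPartition : ℕ → ℕ → List ℕ → Set
IsPartition L N xs = (length xs ≡ L) × All (1 ≤_) xs × Linked _≥_ xs × (sum xs ≡ N)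

InA : List ℕ → Set
InA xs = All (λ x → occ x xs ≤ 2) xs × (Σ₂ xs ≡ + 2) × (unitsGap1 xs ≡ 2)

LHSCond : ℕ → ℕ → ℤ → List ℕ → Set
LHSCond L N m xs = IsPartition L N xs × InA xs × (Σ₁ xs ≡ m)

LHSCond? : ∀ L N m xs → Dec (LHSCond L N m xs)
LHSCond? L N m xs =
  ((length xs ℕ.≟ L) ×-dec all? (1 ≤?_) xs ×-dec linked? _≥?_ xs ×-dec (sum xs ℕ.≟ N))
  ×-dec (all? (λ x → occ x xs ≤? 2) xs ×-dec (Σ₂ xs ℤ.≟ + 2) ×-dec (unitsGap1 xs ℕ.≟ 2))
  ×-dec (Σ₁ xs ℤ.≟ m)

allLists : ℕ → ℕ → List (List ℕ)
allLists zero    N = [] ∷ []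
allLists (suc L) N = concatMap (λ x → map (x ∷_) (allLists L N)) (upTo (suc N))

-- coefficient of z^m q^N in Σ_{λ ∈ 𝒜, λ has exactly L positive parts} z^{Σ₁(λ)} q^{|λ|}
-- (every part of a partition of N is ≤ N, so enumerating allLists L N is exhaustive)
lhsCoef : ℕ → ℤ → ℤ → ℤ
lhsCoef L (+ N)     m = + length (filter (LHSCond? L N m) (allLists L N))
lhsCoef L -[1+ N ]  m = + 0

-- Formal power series in q with coefficients in ℤ[z, z⁻¹]
-- A series s is given by its coefficients: s N m = [q^N z^m] s.

Series : Set
Series = ℕ → ℤ → ℤ

one : Series
one zero (+ 0)      = + 1
one zero (+ suc _)  = + 0
one zero -[1+ _ ]   = + 0
one (suc _) _       = + 0

mulMono : ℤ → ℕ → Series → Series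
mulMono a b s N m = if does (b ≤? N) then s (N ℕ.∸ b) (m ℤ.- a) else + 0

-- division by (1 − z^a q^b) for b ≥ 1, i.e. multiplication by Σ_{j ≥ 0} z^{aj} q^{bj}
-- (only the j with b·j ≤ N contribute to the q^N coefficient, and j ≤ N suffices for b ≥ 1)
divFactor : ℤ → ℕ → Series → Series
divFactor a b s N m =
  sumℤ (map (λ j → if does (b ℕ.* j ≤? N)
                     then s (N ℕ.∸ b ℕ.* j) (m ℤ.- a ℤ.* + j)
                     else + 0)
            (upTo (suc N)))

-- division by (z^a q^c ; q^b)_k = ∏_{i=0}^{k-1} (1 − z^a q^{c+bi})   (used with c ≥ 1)
divPoch : ℤ → ℕ → ℕ → ℕ → Series → Series
divPoch a c b zero    s = s
divPoch a c b (suc k) s = divFactor a (c ℕ.+ b ℕ.* k) (divPoch a c b k s)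

G : ℕ → Series
G n = divPoch (+ 0) 3 3 n
        (divPoch (+ 1) 1 3 (suc n)
          (mulMono (+ suc n) (3 ℕ.* n ℕ.* n ℕ.+ 4 ℕ.* n ℕ.+ 1) one))

-- Laurent polynomials in z and q, as lists of terms (coefficient , z-exponent , q-exponent)
LPoly : Set
LPoly = List (ℤ × ℤ × ℤ)

-- coefficient of a power series, extended by 0 to negative powers of q
at : Series → ℤ → ℤ → ℤ
at s (+ N)    m = s N m
at s -[1+ _ ] m = + 0

mulL : LPoly → Series → ℤ → ℤ → ℤ
mulL p s N m = sumℤ (map (λ { (c , a , b) → c ℤ.* at s (N ℤ.- b) (m ℤ.- a) }) p)

-- the bracket  q²/z² + q³(1 − q^{3n})/z + Σ_{d=1}^{n-1} 1/(z² q^{3n−3d−2})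
bracket : ℕ → LPoly
bracket n =
  (+ 1 , ℤ.- + 2 , + 2) ∷
  (+ 1 , ℤ.- + 1 , + 3) ∷
  (ℤ.- + 1 , ℤ.- + 1 , + 3 ℤ.+ + (3 ℕ.* n)) ∷
  map (λ d → (+ 1 , ℤ.- + 2 , ℤ.- (+ (3 ℕ.* n) ℤ.- + (3 ℕ.* d) ℤ.- + 2)))
      (map suc (upTo (n ℕ.∸ 1)))

rhsCoef : ℕ → ℤ → ℤ → ℤ
rhsCoef n = mulL (bracket n) (G n)

-- A partition λ₁ ≥ … ≥ λ_L > 0 is determined by its differences d_i = λ_i − λ_{i+1} (d_L = λ_L):
-- |λ| = Σ i·d_i, Σ₁ and Σ₂ are the sums of the first and middle differences of the basic units,
-- and a part occurs three times exactly when two adjacent differences vanish. With Σ₂ = 2, exactly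
-- two units of gap 1 and λ_L ≥ 1, every middle difference is 0 except that of the final pair and
-- of one further unit, so the admissible difference vectors fall into finitely many shapes. Each
-- shape is a box of independently constrained coordinates (fixed, or bounded below), so its
-- generating function is a monomial over a product of factors 1/(1 − z^a q^b). These factors are
-- those of G_n up to order, except that 1/(1 − q^{3n}) is missing when the unit of gap 1 is the last
-- one and ends in a zero difference, which accounts for the factor 1 − q^{3n} in the bracket.
-- Comparing monomials matches the shapes with the terms of the bracket.

module Submission where

open import Defs
open import Level using (0ℓ)
open import Function using (_∘_; _∋_)
open import Function.Bundles using (mk⇔)
open import Data.Bool using (if_then_else_)
open import Data.Empty using (⊥; ⊥-elim)
open import Data.Unit using (⊤; tt)
open import Data.Product using (_×_; _,_; proj₁; proj₂; ∃-syntax)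
open import Data.Sum using (inj₁; inj₂)
open import Data.Nat using (ℕ; zero; suc; _≤_; _<_; _≥_; _+_; _*_; _∸_; _≤?_; z≤n; s≤s; >-nonZero)
import Data.Nat.Properties as ℕ
import Data.Nat.Tactic.RingSolver as ℕ-Solver
open import Data.Nat.ListAction using (sum)
open import Data.Nat.ListAction.Properties using (sum-++)
open import Data.Integer as ℤ using (ℤ; +_; -[1+_])
import Data.Integer.Properties as ℤ
import Data.Integer.Tactic.RingSolver as ℤ-Solver
open import Algebra.Properties.CommutativeSemigroup ℕ.+-commutativeSemigroup
  using () renaming (interchange to ℕ-+-interchange)
open import Algebra.Properties.CommutativeSemigroup ℤ.+-commutativeSemigroup
  using () renaming (interchange to ℤ-+-interchange)
open import Data.List using (List; []; _∷_; [_]; map; length; filter; concatMap; upTo; applyUpTo; replicate; _++_; _∷ʳ_)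
import Data.List.Properties as List
open import Data.List.Relation.Unary.All as All using (All; []; _∷_)
import Data.List.Relation.Unary.All.Properties as All
open import Data.List.Relation.Unary.All.Properties using (All¬⇒¬Any)
open import Data.List.Relation.Unary.Any using (here; there)
open import Data.List.Relation.Unary.Linked using (Linked; []; [-]; _∷_)
open import Data.List.Relation.Unary.Unique.Propositional using (Unique; []; _∷_)
import Data.List.Relation.Unary.Unique.Propositional.Properties as Unique
open import Data.List.Membership.Propositional using (_∈_)
open import Data.List.Membership.Propositional.Properties
  using (∈-concat⁺′; ∈-concat⁻′; ∈-map⁺; ∈-map⁻; ∈-upTo⁺; ∈-upTo⁻; ∈-++⁻; ∈-filter⁺; ∈-filter⁻)
open import Data.List.Membership.Propositional.Properties.WithK using (unique∧set⇒bag)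
open import Data.List.Relation.Binary.BagAndSetEquality using (∼bag⇒↭)
open import Data.List.Relation.Binary.Permutation.Propositional as ↭ using (_↭_)
import Data.List.Relation.Binary.Permutation.Propositional.Properties as ↭
open import Relation.Nullary using (Dec; does; yes; no; ¬_)
open import Relation.Nullary.Decidable using (dec-true; dec-false; _×-dec_; ¬?)
open import Relation.Unary using (Pred; Decidable; _⊆_)
open import Relation.Binary.PropositionalEquality
  using (_≡_; _≢_; refl; sym; trans; cong; cong₂; subst; module ≡-Reasoning)

+≤⇒≤∸ : ∀ b c {N} → b + c ≤ N → c ≤ N ∸ b
+≤⇒≤∸ b c {N} b+c≤N = ℕ.m+n≤o⇒m≤o∸n c (subst (_≤ N) (ℕ.+-comm b c) b+c≤N)

≤∸⇒+≤ : ∀ b c {N} → b ≤ N → c ≤ N ∸ b → b + c ≤ N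
≤∸⇒+≤ b c {N} b≤N c≤N∸b = subst (_≤ N) (ℕ.+-comm c b) (ℕ.m≤o∸n⇒m+n≤o c b≤N c≤N∸b)

j≤b*j : ∀ {b} j → 1 ≤ b → j ≤ b * j
j≤b*j {b} j 1≤b = ℕ.m≤n*m j b {{>-nonZero 1≤b}}

m-a*suc[j]≡m-a-a*j : ∀ m a j → m ℤ.- a ℤ.* + suc j ≡ (m ℤ.- a) ℤ.- a ℤ.* + j
m-a*suc[j]≡m-a-a*j m a j = identity m a (+ j)
  where
  identity : ∀ m a y → m ℤ.- a ℤ.* (+ 1 ℤ.+ y) ≡ (m ℤ.- a) ℤ.- a ℤ.* y
  identity = ℤ-Solver.solve-∀

m-n-o≡m-[n+o] : ∀ m n o → m ℤ.- n ℤ.- o ≡ m ℤ.- (n ℤ.+ o)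
m-n-o≡m-[n+o] = ℤ-Solver.solve-∀

m+n-m≡n : ∀ m n → m ℤ.+ n ℤ.- m ≡ n
m+n-m≡n = ℤ-Solver.solve-∀

m+[n-m]≡n : ∀ m n → m ℤ.+ (n ℤ.- m) ≡ n
m+[n-m]≡n = ℤ-Solver.solve-∀

+[m+n]-+m≡+n : ∀ m n → + (m + n) ℤ.- + m ≡ + n
+[m+n]-+m≡+n m n = trans (cong (ℤ._- + m) (ℤ.pos-+ m n)) (m+n-m≡n (+ m) (+ n))

+[m+n]-+n≡+m : ∀ m n → + (m + n) ℤ.- + n ≡ + m
+[m+n]-+n≡+m m n = trans (cong (λ k → + k ℤ.- + n) (ℕ.+-comm m n)) (+[m+n]-+m≡+n n m)

-- Finite sums and formal power series

sumBelow : (ℕ → ℤ) → ℕ → ℤ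
sumBelow f zero    = + 0
sumBelow f (suc M) = f 0 ℤ.+ sumBelow (f ∘ suc) M

sumℤ-map-applyUpTo : ∀ (f : ℕ → ℤ) g M → sumℤ (map f (applyUpTo g M)) ≡ sumBelow (f ∘ g) M
sumℤ-map-applyUpTo f g zero    = refl
sumℤ-map-applyUpTo f g (suc M) = cong (λ t → f (g 0) ℤ.+ t) (sumℤ-map-applyUpTo f (g ∘ suc) M)

sumBelow-cong : ∀ {f g : ℕ → ℤ} M → (∀ j → f j ≡ g j) → sumBelow f M ≡ sumBelow g M
sumBelow-cong zero    f≗g = refl
sumBelow-cong (suc M) f≗g = cong₂ ℤ._+_ (f≗g 0) (sumBelow-cong M (f≗g ∘ suc))

sumBelow-zero : ∀ {f : ℕ → ℤ} M → (∀ j → f j ≡ + 0) → sumBelow f M ≡ + 0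
sumBelow-zero zero    f≗0 = refl
sumBelow-zero (suc M) f≗0 rewrite f≗0 0 | sumBelow-zero M (f≗0 ∘ suc) = refl

sumBelow-+ : ∀ (f g : ℕ → ℤ) M → sumBelow (λ j → f j ℤ.+ g j) M ≡ sumBelow f M ℤ.+ sumBelow g M
sumBelow-+ f g zero    = refl
sumBelow-+ f g (suc M) rewrite sumBelow-+ (f ∘ suc) (g ∘ suc) M =
  ℤ-+-interchange (f 0) (g 0) (sumBelow (f ∘ suc) M) (sumBelow (g ∘ suc) M)

sumBelow-truncate : ∀ (f : ℕ → ℤ) K M → (∀ j → K ≤ j → f j ≡ + 0) → K ≤ M → sumBelow f M ≡ sumBelow f K
sumBelow-truncate f zero    M       f≡0 _         = sumBelow-zero M (λ j → f≡0 j z≤n)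
sumBelow-truncate f (suc K) (suc M) f≡0 (s≤s K≤M) =
  cong (λ t → f 0 ℤ.+ t) (sumBelow-truncate (f ∘ suc) K M (λ j K≤j → f≡0 (suc j) (s≤s K≤j)) K≤M)

sumBelow-single : ∀ (f : ℕ → ℤ) v M → (∀ j → j ≢ v → f j ≡ + 0) → v < M → sumBelow f M ≡ f v
sumBelow-single f zero (suc M) f≡0 _ =
  trans (cong (λ t → f 0 ℤ.+ t) (sumBelow-zero M (λ j → f≡0 (suc j) (λ ())))) (ℤ.+-identityʳ (f 0))
sumBelow-single f (suc v) (suc M) f≡0 (s≤s v<M) =
  trans (cong (ℤ._+ sumBelow (f ∘ suc) M) (f≡0 0 (λ ())))
    (trans (ℤ.+-identityˡ _)
      (sumBelow-single (f ∘ suc) v M (λ j j≢v → f≡0 (suc j) (j≢v ∘ ℕ.suc-injective)) v<M))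

sumBelow-dropInitial : ∀ (f : ℕ → ℤ) v M → (∀ j → j < v → f j ≡ + 0) → v ≤ M →
  sumBelow f M ≡ sumBelow (λ j → f (v + j)) (M ∸ v)
sumBelow-dropInitial f zero    M       f≡0 _         = refl
sumBelow-dropInitial f (suc v) (suc M) f≡0 (s≤s v≤M) =
  trans (cong (ℤ._+ sumBelow (f ∘ suc) M) (f≡0 0 (s≤s z≤n)))
    (trans (ℤ.+-identityˡ _) (sumBelow-dropInitial (f ∘ suc) v M (λ j j<v → f≡0 (suc j) (s≤s j<v)) v≤M))

infix 4 _≗ₛ_
_≗ₛ_ : Series → Series → Set
s ≗ₛ t = ∀ N m → s N m ≡ t N m

infixl 6 _+ₛ_
_+ₛ_ : Series → Series → Series
(s +ₛ t) N m = s N m ℤ.+ t N m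

mulMono-≤ : ∀ a b s N m → b ≤ N → mulMono a b s N m ≡ s (N ∸ b) (m ℤ.- a)
mulMono-≤ a b s N m b≤N rewrite dec-true (b ≤? N) b≤N = refl

mulMono-≰ : ∀ a b s N m → ¬ b ≤ N → mulMono a b s N m ≡ + 0
mulMono-≰ a b s N m b≰N rewrite dec-false (b ≤? N) b≰N = refl

divFactorTerm : ℤ → ℕ → Series → ℕ → ℤ → ℕ → ℤ
divFactorTerm a b s N m j = if does (b * j ≤? N) then s (N ∸ b * j) (m ℤ.- a ℤ.* + j) else + 0

divFactor-sumBelow : ∀ a b s N m → divFactor a b s N m ≡ sumBelow (divFactorTerm a b s N m) (suc N)
divFactor-sumBelow a b s N m = sumℤ-map-applyUpTo (divFactorTerm a b s N m) (λ j → j) (suc N)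

divFactorTerm-zero : ∀ a b s N m → divFactorTerm a b s N m 0 ≡ s N m
divFactorTerm-zero a b s N m rewrite ℕ.*-zeroʳ b | ℤ.*-zeroʳ a | ℤ.+-identityʳ m = refl

divFactorTerm-beyond : ∀ a b s N m j → N < b * j → divFactorTerm a b s N m j ≡ + 0
divFactorTerm-beyond a b s N m j N<bj rewrite dec-false (b * j ≤? N) (ℕ.<⇒≱ N<bj) = refl

divFactorTerm-suc : ∀ a b s {N} m → b ≤ N → ∀ j →
  divFactorTerm a b s N m (suc j) ≡ divFactorTerm a b s (N ∸ b) (m ℤ.- a) j
divFactorTerm-suc a b s {N} m b≤N j with b * j ≤? N ∸ b
... | yes bj≤N∸b
  rewrite dec-true (b * suc j ≤? N) (subst (_≤ N) (sym (ℕ.*-suc b j)) (≤∸⇒+≤ b (b * j) b≤N bj≤N∸b))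
        | ℕ.*-suc b j | sym (ℕ.∸-+-assoc N b (b * j)) | m-a*suc[j]≡m-a-a*j m a j
        | dec-true (b * j ≤? N ∸ b) bj≤N∸b = refl
... | no bj≰N∸b
  rewrite dec-false (b * suc j ≤? N) (bj≰N∸b ∘ +≤⇒≤∸ b (b * j) ∘ subst (_≤ N) (ℕ.*-suc b j))
        | dec-false (b * j ≤? N ∸ b) bj≰N∸b = refl

divFactor-unfold : ∀ a b s → 1 ≤ b → divFactor a b s ≗ₛ s +ₛ mulMono a b (divFactor a b s)
divFactor-unfold a b s 1≤b N m with b ≤? N
... | no b≰N = begin
  divFactor a b s N m                                         ≡⟨ divFactor-sumBelow a b s N m ⟩
  divFactorTerm a b s N m 0 ℤ.+ sumBelow (divFactorTerm a b s N m ∘ suc) N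
    ≡⟨ cong₂ ℤ._+_ (divFactorTerm-zero a b s N m) (sumBelow-zero N tail≡0) ⟩
  s N m ℤ.+ + 0                                               ≡⟨ cong (λ t → s N m ℤ.+ t) (sym (mulMono-≰ a b (divFactor a b s) N m b≰N)) ⟩
  s N m ℤ.+ mulMono a b (divFactor a b s) N m                 ∎
  where
  open ≡-Reasoning
  tail≡0 : ∀ j → divFactorTerm a b s N m (suc j) ≡ + 0
  tail≡0 j = divFactorTerm-beyond a b s N m (suc j) (ℕ.<-≤-trans (ℕ.≰⇒> b≰N) (ℕ.m≤m*n b (suc j)))
... | yes b≤N = begin
  divFactor a b s N m                                         ≡⟨ divFactor-sumBelow a b s N m ⟩
  divFactorTerm a b s N m 0 ℤ.+ sumBelow (divFactorTerm a b s N m ∘ suc) N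
    ≡⟨ cong₂ ℤ._+_ (divFactorTerm-zero a b s N m) (sumBelow-cong N (divFactorTerm-suc a b s m b≤N)) ⟩
  s N m ℤ.+ sumBelow (divFactorTerm a b s (N ∸ b) (m ℤ.- a)) N
    ≡⟨ cong (λ t → s N m ℤ.+ t) (sumBelow-truncate (divFactorTerm a b s (N ∸ b) (m ℤ.- a)) (suc (N ∸ b)) N tail≡0 (N∸b<N)) ⟩
  s N m ℤ.+ sumBelow (divFactorTerm a b s (N ∸ b) (m ℤ.- a)) (suc (N ∸ b))
    ≡⟨ cong (λ t → s N m ℤ.+ t) (sym (trans (mulMono-≤ a b (divFactor a b s) N m b≤N) (divFactor-sumBelow a b s (N ∸ b) (m ℤ.- a)))) ⟩
  s N m ℤ.+ mulMono a b (divFactor a b s) N m                 ∎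
  where
  open ≡-Reasoning
  N∸b<N : N ∸ b < N
  N∸b<N = ℕ.∸-monoʳ-< 1≤b b≤N
  tail≡0 : ∀ j → suc (N ∸ b) ≤ j → divFactorTerm a b s (N ∸ b) (m ℤ.- a) j ≡ + 0
  tail≡0 j N∸b<j = divFactorTerm-beyond a b s (N ∸ b) (m ℤ.- a) j (ℕ.<-≤-trans N∸b<j (j≤b*j j 1≤b))

-- Since b ≥ 1, this recursion determines a series degree by degree.
divFactor-unique : ∀ a b s t → 1 ≤ b → t ≗ₛ s +ₛ mulMono a b t → t ≗ₛ divFactor a b s
divFactor-unique a b s t 1≤b t-rec N m = go N N ℕ.≤-refl m
  where
  go : ∀ K N → N ≤ K → ∀ m → t N m ≡ divFactor a b s N m
  go K N N≤K m with b ≤? N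
  ... | no b≰N = begin
    t N m                                       ≡⟨ t-rec N m ⟩
    s N m ℤ.+ mulMono a b t N m                 ≡⟨ cong (λ x → s N m ℤ.+ x) (mulMono-≰ a b t N m b≰N) ⟩
    s N m ℤ.+ + 0                               ≡⟨ cong (λ x → s N m ℤ.+ x) (sym (mulMono-≰ a b (divFactor a b s) N m b≰N)) ⟩
    s N m ℤ.+ mulMono a b (divFactor a b s) N m ≡⟨ sym (divFactor-unfold a b s 1≤b N m) ⟩
    divFactor a b s N m                         ∎
    where open ≡-Reasoning
  go zero    N N≤0 m | yes b≤N = ⊥-elim (ℕ.<-irrefl refl (ℕ.≤-trans 1≤b (ℕ.≤-trans b≤N N≤0)))
  go (suc K) N N≤K m | yes b≤N = begin
    t N m                                       ≡⟨ t-rec N m ⟩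
    s N m ℤ.+ mulMono a b t N m                 ≡⟨ cong (λ x → s N m ℤ.+ x) (mulMono-≤ a b t N m b≤N) ⟩
    s N m ℤ.+ t (N ∸ b) (m ℤ.- a)               ≡⟨ cong (λ x → s N m ℤ.+ x) (go K (N ∸ b) N∸b≤K (m ℤ.- a)) ⟩
    s N m ℤ.+ divFactor a b s (N ∸ b) (m ℤ.- a) ≡⟨ cong (λ x → s N m ℤ.+ x) (sym (mulMono-≤ a b (divFactor a b s) N m b≤N)) ⟩
    s N m ℤ.+ mulMono a b (divFactor a b s) N m ≡⟨ sym (divFactor-unfold a b s 1≤b N m) ⟩
    divFactor a b s N m                         ∎
    where
    open ≡-Reasoning
    N∸b≤K : N ∸ b ≤ K
    N∸b≤K = ℕ.≤-trans (ℕ.∸-monoʳ-≤ N 1≤b) (ℕ.∸-monoˡ-≤ 1 N≤K)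

mulMono-cong : ∀ a b {s t} → s ≗ₛ t → mulMono a b s ≗ₛ mulMono a b t
mulMono-cong a b s≗t N m = cong (λ x → if does (b ≤? N) then x else + 0) (s≗t (N ∸ b) (m ℤ.- a))

divFactor-cong : ∀ a b {s t} → s ≗ₛ t → divFactor a b s ≗ₛ divFactor a b t
divFactor-cong a b {s} {t} s≗t N m = begin
  divFactor a b s N m                          ≡⟨ divFactor-sumBelow a b s N m ⟩
  sumBelow (divFactorTerm a b s N m) (suc N)   ≡⟨ sumBelow-cong (suc N) term≡ ⟩
  sumBelow (divFactorTerm a b t N m) (suc N)   ≡⟨ sym (divFactor-sumBelow a b t N m) ⟩
  divFactor a b t N m                          ∎
  where
  open ≡-Reasoning
  term≡ : ∀ j → divFactorTerm a b s N m j ≡ divFactorTerm a b t N m j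
  term≡ j = cong (λ x → if does (b * j ≤? N) then x else + 0) (s≗t _ _)

mulMono-+ : ∀ a b s t → mulMono a b (s +ₛ t) ≗ₛ mulMono a b s +ₛ mulMono a b t
mulMono-+ a b s t N m with b ≤? N
... | yes b≤N rewrite dec-true  (b ≤? N) b≤N = refl
... | no  b≰N rewrite dec-false (b ≤? N) b≰N = refl

divFactor-+ : ∀ a b s t → divFactor a b (s +ₛ t) ≗ₛ divFactor a b s +ₛ divFactor a b t
divFactor-+ a b s t N m = begin
  divFactor a b (s +ₛ t) N m                      ≡⟨ divFactor-sumBelow a b (s +ₛ t) N m ⟩
  sumBelow (divFactorTerm a b (s +ₛ t) N m) (suc N)
    ≡⟨ sumBelow-cong (suc N) term≡ ⟩
  sumBelow (λ j → divFactorTerm a b s N m j ℤ.+ divFactorTerm a b t N m j) (suc N)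
    ≡⟨ sumBelow-+ (divFactorTerm a b s N m) (divFactorTerm a b t N m) (suc N) ⟩
  sumBelow (divFactorTerm a b s N m) (suc N) ℤ.+ sumBelow (divFactorTerm a b t N m) (suc N)
    ≡⟨ sym (cong₂ ℤ._+_ (divFactor-sumBelow a b s N m) (divFactor-sumBelow a b t N m)) ⟩
  (divFactor a b s +ₛ divFactor a b t) N m        ∎
  where
  open ≡-Reasoning
  term≡ : ∀ j → divFactorTerm a b (s +ₛ t) N m j ≡ divFactorTerm a b s N m j ℤ.+ divFactorTerm a b t N m j
  term≡ j with b * j ≤? N
  ... | yes bj≤N rewrite dec-true  (b * j ≤? N) bj≤N = refl
  ... | no  bj≰N rewrite dec-false (b * j ≤? N) bj≰N = refl

mulMono-mulMono : ∀ a b c d s → mulMono a b (mulMono c d s) ≗ₛ mulMono (a ℤ.+ c) (b + d) s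
mulMono-mulMono a b c d s N m with b ≤? N
... | no b≰N
  rewrite dec-false (b ≤? N) b≰N | dec-false (b + d ≤? N) (b≰N ∘ ℕ.m+n≤o⇒m≤o b) = refl
... | yes b≤N with d ≤? N ∸ b
...   | yes d≤N∸b
  rewrite dec-true (b ≤? N) b≤N | dec-true (d ≤? N ∸ b) d≤N∸b | dec-true (b + d ≤? N) (≤∸⇒+≤ b d b≤N d≤N∸b)
        | ℕ.∸-+-assoc N b d | m-n-o≡m-[n+o] m a c = refl
...   | no d≰N∸b
  rewrite dec-true (b ≤? N) b≤N | dec-false (d ≤? N ∸ b) d≰N∸b
        | dec-false (b + d ≤? N) (d≰N∸b ∘ +≤⇒≤∸ b d) = refl

mulMono-comm : ∀ a b c d s → mulMono a b (mulMono c d s) ≗ₛ mulMono c d (mulMono a b s)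
mulMono-comm a b c d s N m
  rewrite mulMono-mulMono a b c d s N m | mulMono-mulMono c d a b s N m | ℤ.+-comm a c | ℕ.+-comm b d = refl

divFactor-mulMono : ∀ a b c d s → 1 ≤ b → divFactor a b (mulMono c d s) ≗ₛ mulMono c d (divFactor a b s)
divFactor-mulMono a b c d s 1≤b N m =
  sym (divFactor-unique a b (mulMono c d s) (mulMono c d (divFactor a b s)) 1≤b rec N m)
  where
  rec : mulMono c d (divFactor a b s) ≗ₛ mulMono c d s +ₛ mulMono a b (mulMono c d (divFactor a b s))
  rec N m = trans (mulMono-cong c d (divFactor-unfold a b s 1≤b) N m)
              (trans (mulMono-+ c d s (mulMono a b (divFactor a b s)) N m)
                (cong (λ x → mulMono c d s N m ℤ.+ x) (mulMono-comm c d a b (divFactor a b s) N m)))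

divFactor-comm : ∀ a b c d s → 1 ≤ b → 1 ≤ d → divFactor a b (divFactor c d s) ≗ₛ divFactor c d (divFactor a b s)
divFactor-comm a b c d s 1≤b 1≤d N m =
  sym (divFactor-unique a b (divFactor c d s) (divFactor c d (divFactor a b s)) 1≤b rec N m)
  where
  rec : divFactor c d (divFactor a b s) ≗ₛ divFactor c d s +ₛ mulMono a b (divFactor c d (divFactor a b s))
  rec N m = trans (divFactor-cong c d (divFactor-unfold a b s 1≤b) N m)
              (trans (divFactor-+ c d s (mulMono a b (divFactor a b s)) N m)
                (cong (λ x → divFactor c d s N m ℤ.+ x) (divFactor-mulMono c d a b (divFactor a b s) 1≤d N m)))

Factor : Set
Factor = ℤ × ℕ

PositiveDegree : Factor → Set
PositiveDegree (a , b) = 1 ≤ b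

divFactors : List Factor → Series → Series
divFactors []            s = s
divFactors ((a , b) ∷ l) s = divFactor a b (divFactors l s)

divFactors-++ : ∀ l l′ s → divFactors (l ++ l′) s ≡ divFactors l (divFactors l′ s)
divFactors-++ []            l′ s = refl
divFactors-++ ((a , b) ∷ l) l′ s = cong (divFactor a b) (divFactors-++ l l′ s)

divFactors-mulMono : ∀ l c d s → All PositiveDegree l → divFactors l (mulMono c d s) ≗ₛ mulMono c d (divFactors l s)
divFactors-mulMono []            c d s _        N m = refl
divFactors-mulMono ((a , b) ∷ l) c d s (p ∷ ps) N m =
  trans (divFactor-cong a b (divFactors-mulMono l c d s ps) N m) (divFactor-mulMono a b c d (divFactors l s) p N m)

divFactors-↭ : ∀ {l l′} → l ↭ l′ → All PositiveDegree l → ∀ s → divFactors l s ≗ₛ divFactors l′ s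
divFactors-↭ ↭.refl                   _              s N m = refl
divFactors-↭ (↭.prep (a , b) l↭l′)    (_ ∷ ps)       s     = divFactor-cong a b (divFactors-↭ l↭l′ ps s)
divFactors-↭ {l′ = _ ∷ _ ∷ l′} (↭.swap (a , b) (c , d) l↭l′) (p ∷ q ∷ ps) s N m =
  trans (divFactor-cong a b (divFactor-cong c d (divFactors-↭ l↭l′ ps s)) N m)
        (divFactor-comm a b c d (divFactors l′ s) p q N m)
divFactors-↭ (↭.trans l↭l′ l′↭l″) ps s N m =
  trans (divFactors-↭ l↭l′ ps s N m) (divFactors-↭ l′↭l″ (↭.All-resp-↭ l↭l′ ps) s N m)

indicator : {P : Set} → Dec P → ℕ
indicator P? = if does P? then 1 else 0

indicator-no : ∀ {P : Set} (P? : Dec P) → ¬ P → indicator P? ≡ 0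
indicator-no P? ¬p rewrite dec-false P? ¬p = refl

indicator-⇔ : ∀ {P Q : Set} (P? : Dec P) (Q? : Dec Q) → (P → Q) → (Q → P) → indicator P? ≡ indicator Q?
indicator-⇔ (yes p) (yes q) P⇒Q Q⇒P = refl
indicator-⇔ (no ¬p) (no ¬q) P⇒Q Q⇒P = refl
indicator-⇔ (yes p) (no ¬q) P⇒Q Q⇒P = ⊥-elim (¬q (P⇒Q p))
indicator-⇔ (no ¬p) (yes q) P⇒Q Q⇒P = ⊥-elim (¬p (Q⇒P q))

indicator-× : ∀ {P Q : Set} (P? : Dec P) (Q? : Dec Q) → indicator (P? ×-dec Q?) ≡ indicator P? * indicator Q?
indicator-× (yes p) (yes q) = refl
indicator-× (yes p) (no ¬q) = refl
indicator-× (no ¬p) Q?      = refl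

count : {A : Set} {P : Pred A 0ℓ} → Decidable P → List A → ℕ
count P? xs = length (filter P? xs)

module _ {A : Set} {P : Pred A 0ℓ} (P? : Decidable P) where

  count-∷ : ∀ x xs → count P? (x ∷ xs) ≡ indicator (P? x) + count P? xs
  count-∷ x xs with P? x
  ... | yes _ = refl
  ... | no  _ = refl

  count-++ : ∀ xs ys → count P? (xs ++ ys) ≡ count P? xs + count P? ys
  count-++ xs ys = trans (cong length (List.filter-++ P? xs ys)) (List.length-++ (filter P? xs))

  count-none : ∀ xs → (∀ x → ¬ P x) → count P? xs ≡ 0
  count-none xs ¬P = cong length (List.filter-none P? (All.universal ¬P xs))

  count-≐ : ∀ {Q : Pred A 0ℓ} (Q? : Decidable Q) xs → P ⊆ Q → Q ⊆ P → count P? xs ≡ count Q? xs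
  count-≐ Q? xs P⊆Q Q⊆P = cong length (List.filter-≐ P? Q? (P⊆Q , Q⊆P) xs)

  count-map : ∀ {B : Set} (f : B → A) xs → count P? (map f xs) ≡ count (P? ∘ f) xs
  count-map f []       = refl
  count-map f (x ∷ xs) with P? (f x)
  ... | yes _ = cong suc (count-map f xs)
  ... | no  _ = count-map f xs

  count-concatMap : ∀ {B : Set} (f : B → List A) xs →
    + count P? (concatMap f xs) ≡ sumℤ (map (λ x → + count P? (f x)) xs)
  count-concatMap f []       = refl
  count-concatMap f (x ∷ xs) = begin
    + count P? (f x ++ concatMap f xs)                     ≡⟨ cong +_ (count-++ (f x) (concatMap f xs)) ⟩
    + (count P? (f x) + count P? (concatMap f xs))         ≡⟨ ℤ.pos-+ (count P? (f x)) _ ⟩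
    + count P? (f x) ℤ.+ + count P? (concatMap f xs)       ≡⟨ cong (λ t → + count P? (f x) ℤ.+ t) (count-concatMap f xs) ⟩
    + count P? (f x) ℤ.+ sumℤ (map (λ y → + count P? (f y)) xs) ∎
    where open ≡-Reasoning

module _ {I : Set} where

  sum-map-+ : ∀ (f g : I → ℕ) is → sum (map (λ i → f i + g i) is) ≡ sum (map f is) + sum (map g is)
  sum-map-+ f g []       = refl
  sum-map-+ f g (i ∷ is) rewrite sum-map-+ f g is = ℕ-+-interchange (f i) (g i) (sum (map f is)) (sum (map g is))

  sum-map-*ʳ : ∀ (f : I → ℕ) c is → sum (map (λ i → f i * c) is) ≡ sum (map f is) * c
  sum-map-*ʳ f c []       = refl
  sum-map-*ʳ f c (i ∷ is) rewrite sum-map-*ʳ f c is = sym (ℕ.*-distribʳ-+ c (f i) (sum (map f is)))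

  sumℤ-map-+ : ∀ (f : I → ℕ) is → sumℤ (map (λ i → + f i) is) ≡ + sum (map f is)
  sumℤ-map-+ f []       = refl
  sumℤ-map-+ f (i ∷ is) = trans (cong (λ t → + f i ℤ.+ t) (sumℤ-map-+ f is)) (sym (ℤ.pos-+ (f i) _))

  sumℤ-map-cong : ∀ {f g : I → ℤ} {is} → All (λ i → f i ≡ g i) is → sumℤ (map f is) ≡ sumℤ (map g is)
  sumℤ-map-cong []         = refl
  sumℤ-map-cong (e ∷ es) = cong₂ ℤ._+_ e (sumℤ-map-cong es)

  count-partition : ∀ {A : Set} {P : Pred A 0ℓ} (P? : Decidable P) {Q : I → Pred A 0ℓ} (Q? : ∀ i → Decidable (Q i)) is xs →
    (∀ x → x ∈ xs → indicator (P? x) ≡ sum (map (λ i → indicator (Q? i x)) is)) →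
    count P? xs ≡ sum (map (λ i → count (Q? i) xs) is)
  count-partition P? Q? is []       _     = sym (sum-zeros is)
    where
    sum-zeros : ∀ (is : List I) → sum (map (λ _ → 0) is) ≡ 0
    sum-zeros []       = refl
    sum-zeros (_ ∷ is) = sum-zeros is
  count-partition P? Q? is (x ∷ xs) split = begin
    count P? (x ∷ xs)
      ≡⟨ count-∷ P? x xs ⟩
    indicator (P? x) + count P? xs
      ≡⟨ cong₂ _+_ (split x (here refl)) (count-partition P? Q? is xs (λ y y∈ → split y (there y∈))) ⟩
    sum (map (λ i → indicator (Q? i x)) is) + sum (map (λ i → count (Q? i) xs) is)
      ≡⟨ sym (sum-map-+ (λ i → indicator (Q? i x)) (λ i → count (Q? i) xs) is) ⟩
    sum (map (λ i → indicator (Q? i x) + count (Q? i) xs) is)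
      ≡⟨ cong sum (List.map-cong (λ i → sym (count-∷ (Q? i) x xs)) is) ⟩
    sum (map (λ i → count (Q? i) (x ∷ xs)) is) ∎
    where open ≡-Reasoning

count-allLists-suc : ∀ {P : Pred (List ℕ) 0ℓ} (P? : Decidable P) L Nb →
  + count P? (allLists (suc L) Nb) ≡ sumBelow (λ x → + count (P? ∘ (x ∷_)) (allLists L Nb)) (suc Nb)
count-allLists-suc P? L Nb = begin
  + count P? (allLists (suc L) Nb)
    ≡⟨ count-concatMap P? (λ x → map (x ∷_) (allLists L Nb)) (upTo (suc Nb)) ⟩
  sumℤ (map (λ x → + count P? (map (x ∷_) (allLists L Nb))) (upTo (suc Nb)))
    ≡⟨ cong sumℤ (List.map-cong (λ x → cong +_ (count-map P? (x ∷_) (allLists L Nb))) (upTo (suc Nb))) ⟩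
  sumℤ (map (λ x → + count (P? ∘ (x ∷_)) (allLists L Nb)) (upTo (suc Nb)))
    ≡⟨ sumℤ-map-applyUpTo (λ x → + count (P? ∘ (x ∷_)) (allLists L Nb)) (λ x → x) (suc Nb) ⟩
  sumBelow (λ x → + count (P? ∘ (x ∷_)) (allLists L Nb)) (suc Nb) ∎
  where open ≡-Reasoning

-- Generating functions of constrained coordinates

data Constraint : Set where
  exactly atLeast : ℕ → Constraint

Satisfies : Constraint → ℕ → Set
Satisfies (exactly v) d = d ≡ v
Satisfies (atLeast v) d = v ≤ d

Satisfies? : ∀ c d → Dec (Satisfies c d)
Satisfies? (exactly v) d = d ℕ.≟ v
Satisfies? (atLeast v) d = v ≤? d

-- A coordinate d in a slot (c , w , u) is subject to c and contributes z^{u d} q^{w d}.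
Slot : Set
Slot = Constraint × ℕ × ℕ

Fits : List Slot → List ℕ → Set
Fits []                  []       = ⊤
Fits []                  (_ ∷ _)  = ⊥
Fits (_ ∷ _)             []       = ⊥
Fits ((c , w , u) ∷ es) (d ∷ ds) = Satisfies c d × Fits es ds

Fits? : ∀ es ds → Dec (Fits es ds)
Fits? []                 []       = yes tt
Fits? []                 (_ ∷ _)  = no λ ()
Fits? (_ ∷ _)            []       = no λ ()
Fits? ((c , w , u) ∷ es) (d ∷ ds) = Satisfies? c d ×-dec Fits? es ds

qDegree zDegree : List Slot → List ℕ → ℕ
qDegree ((c , w , u) ∷ es) (d ∷ ds) = w * d + qDegree es ds
qDegree _                  _        = 0
zDegree ((c , w , u) ∷ es) (d ∷ ds) = u * d + zDegree es ds
zDegree _                  _        = 0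

Solves : List Slot → ℕ → ℤ → List ℕ → Set
Solves es N m ds = Fits es ds × qDegree es ds ≡ N × + zDegree es ds ≡ m

Solves? : ∀ es N m → Decidable (Solves es N m)
Solves? es N m ds = Fits? es ds ×-dec (qDegree es ds ℕ.≟ N ×-dec (+ zDegree es ds ℤ.≟ m))

solutionCount : List Slot → ℕ → ℕ → ℤ → ℤ
solutionCount es Nb N m = + count (Solves? es N m) (allLists (length es) Nb)

slotFactor : Slot → Series → Series
slotFactor (exactly v , w , u) s = mulMono (+ (u * v)) (w * v) s
slotFactor (atLeast v , w , u) s = mulMono (+ (u * v)) (w * v) (divFactor (+ u) w s)

slotSeries : List Slot → Series
slotSeries []       = one
slotSeries (e ∷ es) = slotFactor e (slotSeries es)

PositiveWeight : Slot → Set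
PositiveWeight (c , w , u) = 1 ≤ w

slotTerm : Slot → Series → ℕ → ℤ → ℕ → ℤ
slotTerm (c , w , u) s N m x =
  if does (Satisfies? c x ×-dec w * x ≤? N) then s (N ∸ w * x) (m ℤ.- + (u * x)) else + 0

module _ (c : Constraint) (w u : ℕ) (s : Series) (N : ℕ) (m : ℤ) where

  slotTerm-fits : ∀ x → Satisfies c x → w * x ≤ N → slotTerm (c , w , u) s N m x ≡ s (N ∸ w * x) (m ℤ.- + (u * x))
  slotTerm-fits x cx wx≤N rewrite dec-true (Satisfies? c x ×-dec w * x ≤? N) (cx , wx≤N) = refl

  slotTerm-misfit : ∀ x → ¬ (Satisfies c x × w * x ≤ N) → slotTerm (c , w , u) s N m x ≡ + 0
  slotTerm-misfit x ¬fit rewrite dec-false (Satisfies? c x ×-dec w * x ≤? N) ¬fit = refl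

sumBelow-slotTerm-exactly : ∀ v w u s N m Nb → 1 ≤ w → N ≤ Nb →
  sumBelow (slotTerm (exactly v , w , u) s N m) (suc Nb) ≡ slotFactor (exactly v , w , u) s N m
sumBelow-slotTerm-exactly v w u s N m Nb 1≤w N≤Nb with w * v ≤? N
... | yes wv≤N = begin
  sumBelow (slotTerm (exactly v , w , u) s N m) (suc Nb)
    ≡⟨ sumBelow-single _ v (suc Nb) (λ x x≢v → slotTerm-misfit (exactly v) w u s N m x (x≢v ∘ proj₁))
         (s≤s (ℕ.≤-trans (j≤b*j v 1≤w) (ℕ.≤-trans wv≤N N≤Nb))) ⟩
  slotTerm (exactly v , w , u) s N m v  ≡⟨ slotTerm-fits (exactly v) w u s N m v refl wv≤N ⟩
  s (N ∸ w * v) (m ℤ.- + (u * v))       ≡⟨ sym (mulMono-≤ (+ (u * v)) (w * v) s N m wv≤N) ⟩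
  slotFactor (exactly v , w , u) s N m  ∎
  where open ≡-Reasoning
... | no wv≰N =
  trans (sumBelow-zero (suc Nb) (λ x → slotTerm-misfit (exactly v) w u s N m x λ { (refl , wv≤N) → wv≰N wv≤N }))
        (sym (mulMono-≰ (+ (u * v)) (w * v) s N m wv≰N))

slotTerm-atLeast-shift : ∀ v w u s N m → w * v ≤ N → ∀ j →
  slotTerm (atLeast v , w , u) s N m (v + j) ≡ divFactorTerm (+ u) w s (N ∸ w * v) (m ℤ.- + (u * v)) j
slotTerm-atLeast-shift v w u s N m wv≤N j with w * j ≤? N ∸ w * v
... | yes wj≤N∸wv rewrite dec-true (w * j ≤? N ∸ w * v) wj≤N∸wv = begin
  slotTerm (atLeast v , w , u) s N m (v + j)
    ≡⟨ slotTerm-fits (atLeast v) w u s N m (v + j) (ℕ.m≤m+n v j) w[v+j]≤N ⟩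
  s (N ∸ w * (v + j)) (m ℤ.- + (u * (v + j)))
    ≡⟨ cong₂ s (trans (cong (N ∸_) (ℕ.*-distribˡ-+ w v j)) (sym (ℕ.∸-+-assoc N (w * v) (w * j)))) z-shift ⟩
  s (N ∸ w * v ∸ w * j) (m ℤ.- + (u * v) ℤ.- + u ℤ.* + j) ∎
  where
  open ≡-Reasoning
  w[v+j]≤N : w * (v + j) ≤ N
  w[v+j]≤N = subst (_≤ N) (sym (ℕ.*-distribˡ-+ w v j)) (≤∸⇒+≤ (w * v) (w * j) wv≤N wj≤N∸wv)
  z-shift : m ℤ.- + (u * (v + j)) ≡ m ℤ.- + (u * v) ℤ.- + u ℤ.* + j
  z-shift = begin
    m ℤ.- + (u * (v + j))          ≡⟨ cong (λ t → m ℤ.- + t) (ℕ.*-distribˡ-+ u v j) ⟩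
    m ℤ.- + (u * v + u * j)        ≡⟨ cong (λ t → m ℤ.- t) (ℤ.pos-+ (u * v) (u * j)) ⟩
    m ℤ.- (+ (u * v) ℤ.+ + (u * j)) ≡⟨ sym (m-n-o≡m-[n+o] m (+ (u * v)) (+ (u * j))) ⟩
    m ℤ.- + (u * v) ℤ.- + (u * j)   ≡⟨ cong (λ t → m ℤ.- + (u * v) ℤ.- t) (ℤ.pos-* u j) ⟩
    m ℤ.- + (u * v) ℤ.- + u ℤ.* + j ∎
... | no wj≰N∸wv rewrite dec-false (w * j ≤? N ∸ w * v) wj≰N∸wv =
  slotTerm-misfit (atLeast v) w u s N m (v + j) λ (_ , w[v+j]≤N) →
    wj≰N∸wv (+≤⇒≤∸ (w * v) (w * j) (subst (_≤ N) (ℕ.*-distribˡ-+ w v j) w[v+j]≤N))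

sumBelow-slotTerm-atLeast : ∀ v w u s N m Nb → 1 ≤ w → N ≤ Nb →
  sumBelow (slotTerm (atLeast v , w , u) s N m) (suc Nb) ≡ slotFactor (atLeast v , w , u) s N m
sumBelow-slotTerm-atLeast v w u s N m Nb 1≤w N≤Nb with w * v ≤? N
... | no wv≰N =
  trans (sumBelow-zero (suc Nb) λ x → slotTerm-misfit (atLeast v) w u s N m x
           λ (v≤x , wx≤N) → wv≰N (ℕ.≤-trans (ℕ.*-monoʳ-≤ w v≤x) wx≤N))
        (sym (mulMono-≰ (+ (u * v)) (w * v) (divFactor (+ u) w s) N m wv≰N))
... | yes wv≤N = begin
  sumBelow (slotTerm (atLeast v , w , u) s N m) (suc Nb)
    ≡⟨ sumBelow-dropInitial _ v (suc Nb)
         (λ x x<v → slotTerm-misfit (atLeast v) w u s N m x λ (v≤x , _) → ℕ.<⇒≱ x<v v≤x)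
         (ℕ.≤-trans (j≤b*j v 1≤w) (ℕ.≤-trans wv≤N (ℕ.m≤n⇒m≤1+n N≤Nb))) ⟩
  sumBelow (λ j → slotTerm (atLeast v , w , u) s N m (v + j)) (suc Nb ∸ v)
    ≡⟨ sumBelow-cong (suc Nb ∸ v) (slotTerm-atLeast-shift v w u s N m wv≤N) ⟩
  sumBelow (divFactorTerm (+ u) w s N′ m′) (suc Nb ∸ v)
    ≡⟨ sumBelow-truncate _ (suc N′) (suc Nb ∸ v) tail≡0 N′<1+Nb∸v ⟩
  sumBelow (divFactorTerm (+ u) w s N′ m′) (suc N′)
    ≡⟨ sym (divFactor-sumBelow (+ u) w s N′ m′) ⟩
  divFactor (+ u) w s N′ m′
    ≡⟨ sym (mulMono-≤ (+ (u * v)) (w * v) (divFactor (+ u) w s) N m wv≤N) ⟩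
  slotFactor (atLeast v , w , u) s N m ∎
  where
  open ≡-Reasoning
  N′ = N ∸ w * v
  m′ = m ℤ.- + (u * v)
  tail≡0 : ∀ j → suc N′ ≤ j → divFactorTerm (+ u) w s N′ m′ j ≡ + 0
  tail≡0 j N′<j = divFactorTerm-beyond (+ u) w s N′ m′ j (ℕ.<-≤-trans N′<j (j≤b*j j 1≤w))
  N′<1+Nb∸v : suc N′ ≤ suc Nb ∸ v
  N′<1+Nb∸v = subst (suc N′ ≤_) (sym (ℕ.+-∸-assoc 1 (ℕ.≤-trans (j≤b*j v 1≤w) (ℕ.≤-trans wv≤N N≤Nb))))
                (s≤s (ℕ.≤-trans (ℕ.∸-monoʳ-≤ N (j≤b*j v 1≤w)) (ℕ.∸-monoˡ-≤ v N≤Nb)))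

sumBelow-slotTerm : ∀ e s N m Nb → PositiveWeight e → N ≤ Nb →
  sumBelow (slotTerm e s N m) (suc Nb) ≡ slotFactor e s N m
sumBelow-slotTerm (exactly v , w , u) = sumBelow-slotTerm-exactly v w u
sumBelow-slotTerm (atLeast v , w , u) = sumBelow-slotTerm-atLeast v w u

count-solutions-cons : ∀ e es N m x xs →
  + count (Solves? (e ∷ es) N m ∘ (x ∷_)) xs ≡ slotTerm e (λ N′ m′ → + count (Solves? es N′ m′) xs) N m x
count-solutions-cons (c , w , u) es N m x xs with Satisfies? c x ×-dec w * x ≤? N
... | yes (cx , wx≤N) =
  trans (cong +_ (count-≐ _ (Solves? es (N ∸ w * x) (m ℤ.- + (u * x))) xs forth back))
        (sym (slotTerm-fits c w u (λ N′ m′ → + count (Solves? es N′ m′) xs) N m x cx wx≤N))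
  where
  forth : ∀ {ds} → Solves ((c , w , u) ∷ es) N m (x ∷ ds) → Solves es (N ∸ w * x) (m ℤ.- + (u * x)) ds
  forth {ds} ((_ , fits) , refl , refl) =
    fits , sym (ℕ.m+n∸m≡n (w * x) (qDegree es ds)) ,
    sym (trans (cong (ℤ._- + (u * x)) (ℤ.pos-+ (u * x) (zDegree es ds))) (m+n-m≡n (+ (u * x)) _))
  back : ∀ {ds} → Solves es (N ∸ w * x) (m ℤ.- + (u * x)) ds → Solves ((c , w , u) ∷ es) N m (x ∷ ds)
  back {ds} (fits , eq , eZ) =
    (cx , fits) , trans (cong (λ t → w * x + t) eq) (ℕ.m+[n∸m]≡n wx≤N) ,
    trans (ℤ.pos-+ (u * x) (zDegree es ds)) (trans (cong (λ t → + (u * x) ℤ.+ t) eZ) (m+[n-m]≡n (+ (u * x)) m))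
... | no ¬fit =
  trans (cong +_ (count-none _ xs λ ds ((cx , _) , qd , _) →
           ¬fit (cx , subst (w * x ≤_) qd (ℕ.m≤m+n (w * x) (qDegree es ds)))))
        (sym (slotTerm-misfit c w u (λ N′ m′ → + count (Solves? es N′ m′) xs) N m x ¬fit))

slotTerm-cong-≤ : ∀ e {s t} N m x → (∀ N′ m′ → N′ ≤ N → s N′ m′ ≡ t N′ m′) → slotTerm e s N m x ≡ slotTerm e t N m x
slotTerm-cong-≤ (c , w , u) {s} {t} N m x s≡t with Satisfies? c x ×-dec w * x ≤? N
... | yes (cx , wx≤N) = begin
  slotTerm (c , w , u) s N m x        ≡⟨ slotTerm-fits c w u s N m x cx wx≤N ⟩
  s (N ∸ w * x) (m ℤ.- + (u * x))     ≡⟨ s≡t _ _ (ℕ.m∸n≤m N (w * x)) ⟩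
  t (N ∸ w * x) (m ℤ.- + (u * x))     ≡⟨ sym (slotTerm-fits c w u t N m x cx wx≤N) ⟩
  slotTerm (c , w , u) t N m x        ∎
  where open ≡-Reasoning
... | no ¬fit = trans (slotTerm-misfit c w u s N m x ¬fit) (sym (slotTerm-misfit c w u t N m x ¬fit))

solutionCount≡slotSeries : ∀ es → All PositiveWeight es → ∀ Nb N m → N ≤ Nb → solutionCount es Nb N m ≡ slotSeries es N m
solutionCount≡slotSeries []       _        Nb zero    (+ zero)  _ = refl
solutionCount≡slotSeries []       _        Nb zero    (+ suc _) _ = refl
solutionCount≡slotSeries []       _        Nb zero    -[1+ _ ]  _ = refl
solutionCount≡slotSeries []       _        Nb (suc N) m         _ = refl
solutionCount≡slotSeries (e ∷ es) (p ∷ ps) Nb N m N≤Nb = begin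
  solutionCount (e ∷ es) Nb N m
    ≡⟨ count-allLists-suc (Solves? (e ∷ es) N m) (length es) Nb ⟩
  sumBelow (λ x → + count (Solves? (e ∷ es) N m ∘ (x ∷_)) (allLists (length es) Nb)) (suc Nb)
    ≡⟨ sumBelow-cong (suc Nb) (λ x → trans (count-solutions-cons e es N m x (allLists (length es) Nb)) (slotTerm-cong-≤ e N m x ih)) ⟩
  sumBelow (slotTerm e (slotSeries es) N m) (suc Nb)
    ≡⟨ sumBelow-slotTerm e (slotSeries es) N m Nb p N≤Nb ⟩
  slotSeries (e ∷ es) N m ∎
  where
  open ≡-Reasoning
  ih : ∀ N′ m′ → N′ ≤ N → solutionCount es Nb N′ m′ ≡ slotSeries es N′ m′
  ih N′ m′ N′≤N = solutionCount≡slotSeries es ps Nb N′ m′ (ℕ.≤-trans N′≤N N≤Nb)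

-- Partitions and their difference vectors

suffixSums : List ℕ → List ℕ
suffixSums []       = []
suffixSums (d ∷ ds) = (d + sum ds) ∷ suffixSums ds

differences : List ℕ → List ℕ
differences []          = []
differences (x ∷ [])    = x ∷ []
differences (x ∷ y ∷ r) = (x ∸ y) ∷ differences (y ∷ r)

length-suffixSums : ∀ ds → length (suffixSums ds) ≡ length ds
length-suffixSums []       = refl
length-suffixSums (d ∷ ds) = cong suc (length-suffixSums ds)

length-differences : ∀ xs → length (differences xs) ≡ length xs
length-differences []          = refl
length-differences (x ∷ [])    = refl
length-differences (x ∷ y ∷ r) = cong suc (length-differences (y ∷ r))

suffixSums-injective : ∀ {ds es} → suffixSums ds ≡ suffixSums es → ds ≡ es
suffixSums-injective {[]}     {[]}     _  = refl
suffixSums-injective {d ∷ ds} {e ∷ es} eq with List.∷-injective eq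
... | d+Σds≡e+Σes , tails≡ with suffixSums-injective {ds} {es} tails≡
... | refl = cong (_∷ es) (ℕ.+-cancelʳ-≡ (sum es) d e d+Σds≡e+Σes)

suffixSums-nonincreasing : ∀ ds → Linked _≥_ (suffixSums ds)
suffixSums-nonincreasing []            = []
suffixSums-nonincreasing (d ∷ [])      = [-]
suffixSums-nonincreasing (d ∷ d′ ∷ ds) = ℕ.m≤n+m (d′ + sum ds) d ∷ suffixSums-nonincreasing (d′ ∷ ds)

suffixSums-differences : ∀ xs → Linked _≥_ xs → suffixSums (differences xs) ≡ xs
suffixSums-differences []          _             = refl
suffixSums-differences (x ∷ [])    _             = cong (_∷ []) (ℕ.+-identityʳ x)
suffixSums-differences (x ∷ y ∷ r) (x≥y ∷ y∷r↓) = cong₂ _∷_ head≡ ih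
  where
  ih = suffixSums-differences (y ∷ r) y∷r↓
  sum≡y : sum (differences (y ∷ r)) ≡ y
  sum≡y with differences (y ∷ r) | ih
  ... | d ∷ ds | refl = refl
  head≡ : x ∸ y + sum (differences (y ∷ r)) ≡ x
  head≡ = trans (cong (λ t → x ∸ y + t) sum≡y) (ℕ.m∸n+n≡m x≥y)

All-≤-sum : ∀ xs → All (_≤ sum xs) xs
All-≤-sum []       = []
All-≤-sum (x ∷ xs) = ℕ.m≤m+n x (sum xs) ∷ All.map (λ x≤Σ → ℕ.≤-trans x≤Σ (ℕ.m≤n+m (sum xs) x)) (All-≤-sum xs)

differences-bounded : ∀ N xs → All (_≤ N) xs → All (_≤ N) (differences xs)
differences-bounded N []          _        = []
differences-bounded N (x ∷ [])    (p ∷ _)  = p ∷ []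
differences-bounded N (x ∷ y ∷ r) (p ∷ ps) = ℕ.≤-trans (ℕ.m∸n≤m x y) p ∷ differences-bounded N (y ∷ r) ps

∈-allLists⁺ : ∀ L N xs → length xs ≡ L → All (_≤ N) xs → xs ∈ allLists L N
∈-allLists⁺ zero    N []       refl []         = here refl
∈-allLists⁺ (suc L) N (x ∷ xs) len  (x≤N ∷ ps) =
  ∈-concat⁺′ (∈-map⁺ (x ∷_) (∈-allLists⁺ L N xs (ℕ.suc-injective len) ps))
             (∈-map⁺ (λ y → map (y ∷_) (allLists L N)) (∈-upTo⁺ (s≤s x≤N)))

∈-allLists⁻ : ∀ L N xs → xs ∈ allLists L N → length xs ≡ L × All (_≤ N) xs
∈-allLists⁻ zero    N .[] (here refl) = refl , []
∈-allLists⁻ (suc L) N xs  xs∈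
  with ∈-concat⁻′ (map (λ y → map (y ∷_) (allLists L N)) (upTo (suc N))) xs∈
... | vs , xs∈vs , vs∈ with ∈-map⁻ (λ y → map (y ∷_) (allLists L N)) vs∈
... | y , y∈ , refl with ∈-map⁻ (y ∷_) xs∈vs
... | zs , zs∈ , refl with ∈-allLists⁻ L N zs zs∈
... | len , bounded = cong suc len , ℕ.≤-pred (∈-upTo⁻ y∈) ∷ bounded

module _ (tails : List (List ℕ)) where

  private
    prefixes : List ℕ → List (List ℕ)
    prefixes = concatMap (λ x → map (x ∷_) tails)

    head∈ : ∀ xs {v} → v ∈ prefixes xs → ∃[ y ] y ∈ xs × ∃[ zs ] v ≡ y ∷ zs
    head∈ (x ∷ xs) v∈ with ∈-++⁻ (map (x ∷_) tails) v∈
    ... | inj₁ v∈x∷ with ∈-map⁻ (x ∷_) v∈x∷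
    ...   | zs , _ , v≡ = x , here refl , zs , v≡
    head∈ (x ∷ xs) v∈ | inj₂ v∈xs with head∈ xs v∈xs
    ...   | y , y∈ , zs , v≡ = y , there y∈ , zs , v≡

  prefixes-unique : Unique tails → ∀ xs → Unique xs → Unique (prefixes xs)
  prefixes-unique _       []       _            = []
  prefixes-unique !tails (x ∷ xs) (x∉xs ∷ !xs) =
    Unique.++⁺ (Unique.map⁺ (proj₂ ∘ List.∷-injective) !tails) (prefixes-unique !tails xs !xs) disjoint
    where
    disjoint : ∀ {v} → ¬ (v ∈ map (x ∷_) tails × v ∈ prefixes xs)
    disjoint (v∈x∷ , v∈xs) with ∈-map⁻ (x ∷_) v∈x∷ | head∈ xs v∈xs
    ... | _ , _ , refl | y , y∈ , _ , v≡ =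
      All¬⇒¬Any x∉xs (subst (_∈ xs) (sym (proj₁ (List.∷-injective v≡))) y∈)

allLists-unique : ∀ L N → Unique (allLists L N)
allLists-unique zero    N = [] ∷ []
allLists-unique (suc L) N = prefixes-unique (allLists L N) (allLists-unique L N) (upTo (suc N)) (Unique.upTo⁺ (suc N))

count-differences : ∀ L N {P Q : Pred (List ℕ) 0ℓ} (P? : Decidable P) (Q? : Decidable Q) →
  (∀ xs → length xs ≡ L → All (_≤ N) xs → P xs → Q (differences xs) × Linked _≥_ xs) →
  (∀ ds → length ds ≡ L → All (_≤ N) ds → Q ds → P (suffixSums ds) × All (_≤ N) (suffixSums ds)) →
  count P? (allLists L N) ≡ count Q? (allLists L N)
count-differences L N {P} {Q} P? Q? P⇒Q Q⇒P =
  trans (↭.↭-length (∼bag⇒↭ (unique∧set⇒bag !Ps !sQs (mk⇔ forth back))))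
        (List.length-map suffixSums (filter Q? As))
  where
  As = allLists L N
  !Ps : Unique (filter P? As)
  !Ps = Unique.filter⁺ P? (allLists-unique L N)
  !sQs : Unique (map suffixSums (filter Q? As))
  !sQs = Unique.map⁺ suffixSums-injective (Unique.filter⁺ Q? (allLists-unique L N))
  forth : ∀ {xs} → xs ∈ filter P? As → xs ∈ map suffixSums (filter Q? As)
  forth {xs} xs∈ with ∈-filter⁻ P? {xs = As} xs∈
  ... | xs∈As , Pxs with ∈-allLists⁻ L N xs xs∈As
  ... | len , bounded with P⇒Q xs len bounded Pxs
  ... | Qds , xs↓ = subst (_∈ map suffixSums (filter Q? As)) (suffixSums-differences xs xs↓)
    (∈-map⁺ suffixSums (∈-filter⁺ Q?
      (∈-allLists⁺ L N (differences xs) (trans (length-differences xs) len) (differences-bounded N xs bounded)) Qds))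
  back : ∀ {xs} → xs ∈ map suffixSums (filter Q? As) → xs ∈ filter P? As
  back xs∈ with ∈-map⁻ suffixSums xs∈
  ... | ds , ds∈ , refl with ∈-filter⁻ Q? {xs = As} ds∈
  ... | ds∈As , Qds with ∈-allLists⁻ L N ds ds∈As
  ... | len , bounded with Q⇒P ds len bounded Qds
  ... | Pxs , xs-bounded =
    ∈-filter⁺ P? (∈-allLists⁺ L N (suffixSums ds) (trans (length-suffixSums ds) len) xs-bounded) Pxs

weightedSum : ℕ → List ℕ → ℕ
weightedSum k []       = 0
weightedSum k (d ∷ ds) = suc k * d + weightedSum (suc k) ds

weightedSum-suffixSums : ∀ k ds → weightedSum k ds ≡ k * sum ds + sum (suffixSums ds)
weightedSum-suffixSums k []       = sym (trans (ℕ.+-identityʳ (k * 0)) (ℕ.*-zeroʳ k))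
weightedSum-suffixSums k (d ∷ ds) rewrite weightedSum-suffixSums (suc k) ds =
  identity k d (sum ds) (sum (suffixSums ds))
  where
  identity : ∀ k d s p → suc k * d + (suc k * s + p) ≡ k * (d + s) + ((d + s) + p)
  identity = ℕ-Solver.solve-∀

sum-suffixSums : ∀ ds → sum (suffixSums ds) ≡ weightedSum 0 ds
sum-suffixSums ds = sym (weightedSum-suffixSums 0 ds)

isOne : ℕ → ℕ
isOne 1 = 1
isOne _ = 0

-- Σ₁, Σ₂ and unitsGap1 in terms of the differences d₁, d₂, … (d_L = λ_L).
firstSum middleSum middleOnes : List ℕ → ℕ
firstSum []              = 0
firstSum (a ∷ [])        = a
firstSum (a ∷ b ∷ [])    = a
firstSum (a ∷ b ∷ c ∷ r) = a + firstSum r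
middleSum []              = 0
middleSum (a ∷ [])        = 0
middleSum (a ∷ b ∷ [])    = b
middleSum (a ∷ b ∷ c ∷ r) = b + middleSum r
middleOnes []              = 0
middleOnes (a ∷ [])        = 0
middleOnes (a ∷ b ∷ [])    = isOne b
middleOnes (a ∷ b ∷ c ∷ r) = isOne b + middleOnes r

Σ₁-suffixSums : ∀ ds → Σ₁ (suffixSums ds) ≡ + firstSum ds
Σ₁-suffixSums []              = refl
Σ₁-suffixSums (a ∷ [])        = trans (ℤ.+-identityʳ _) (+[m+n]-+n≡+m a 0)
Σ₁-suffixSums (a ∷ b ∷ [])    = trans (ℤ.+-identityʳ _) (+[m+n]-+n≡+m a (b + 0))
Σ₁-suffixSums (a ∷ b ∷ c ∷ r) =
  trans (cong₂ ℤ._+_ (+[m+n]-+n≡+m a (b + (c + sum r))) (Σ₁-suffixSums r)) (sym (ℤ.pos-+ a (firstSum r)))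

Σ₂-suffixSums : ∀ ds → Σ₂ (suffixSums ds) ≡ + middleSum ds
Σ₂-suffixSums []              = refl
Σ₂-suffixSums (a ∷ [])        = refl
Σ₂-suffixSums (a ∷ b ∷ [])    = trans (ℤ.+-identityʳ _) (+[m+n]-+n≡+m b 0)
Σ₂-suffixSums (a ∷ b ∷ c ∷ r) =
  trans (cong₂ ℤ._+_ (+[m+n]-+n≡+m b (c + sum r)) (Σ₂-suffixSums r)) (sym (ℤ.pos-+ b (middleSum r)))

isOne-≟ : ∀ t b → t ≡ + b → indicator (t ℤ.≟ + 1) ≡ isOne b
isOne-≟ t b t≡b with t ℤ.≟ + 1
isOne-≟ t b t≡b | yes t≡1 with trans (sym t≡b) t≡1
... | refl = refl
isOne-≟ t zero          t≡b | no _   = refl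
isOne-≟ t (suc zero)    t≡b | no t≢1 = ⊥-elim (t≢1 t≡b)
isOne-≟ t (suc (suc b)) t≡b | no _   = refl

unitsGap1-∷ : ∀ x y z zs →
  unitsGap1 (x ∷ y ∷ z ∷ zs) ≡ indicator ((+ y ℤ.- + z) ℤ.≟ + 1) + unitsGap1 zs
unitsGap1-∷ x y z zs with (+ y ℤ.- + z) ℤ.≟ + 1
... | yes _ = refl
... | no  _ = refl

unitsGap1-pair : ∀ x y → unitsGap1 (x ∷ y ∷ []) ≡ isOne y
unitsGap1-pair x zero          = refl
unitsGap1-pair x (suc zero)    = refl
unitsGap1-pair x (suc (suc y)) = refl

unitsGap1-suffixSums : ∀ ds → unitsGap1 (suffixSums ds) ≡ middleOnes ds
unitsGap1-suffixSums []              = refl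
unitsGap1-suffixSums (a ∷ [])        = refl
unitsGap1-suffixSums (a ∷ b ∷ [])    = trans (unitsGap1-pair _ _) (cong isOne (ℕ.+-identityʳ b))
unitsGap1-suffixSums (a ∷ b ∷ c ∷ r) =
  trans (unitsGap1-∷ _ (b + (c + sum r)) (c + sum r) (suffixSums r))
        (cong₂ _+_ (isOne-≟ _ b (+[m+n]-+n≡+m b (c + sum r))) (unitsGap1-suffixSums r))

LastPositive : List ℕ → Set
LastPositive []            = ⊤
LastPositive (d ∷ [])      = 1 ≤ d
LastPositive (d ∷ d′ ∷ ds) = LastPositive (d′ ∷ ds)

LastPositive? : ∀ ds → Dec (LastPositive ds)
LastPositive? []            = yes tt
LastPositive? (d ∷ [])      = 1 ≤? d
LastPositive? (d ∷ d′ ∷ ds) = LastPositive? (d′ ∷ ds)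

All-positive⇒LastPositive : ∀ ds → All (1 ≤_) (suffixSums ds) → LastPositive ds
All-positive⇒LastPositive []            _       = tt
All-positive⇒LastPositive (d ∷ [])      (p ∷ _) = subst (1 ≤_) (ℕ.+-identityʳ d) p
All-positive⇒LastPositive (d ∷ d′ ∷ ds) (_ ∷ ps) = All-positive⇒LastPositive (d′ ∷ ds) ps

LastPositive⇒All-positive : ∀ ds → LastPositive ds → All (1 ≤_) (suffixSums ds)
LastPositive⇒All-positive []            _ = []
LastPositive⇒All-positive (d ∷ [])      p = subst (1 ≤_) (sym (ℕ.+-identityʳ d)) p ∷ []
LastPositive⇒All-positive (d ∷ d′ ∷ ds) p with LastPositive⇒All-positive (d′ ∷ ds) p
... | q ∷ qs = ℕ.≤-trans q (ℕ.m≤n+m _ d) ∷ q ∷ qs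

-- A part occurs three times iff two adjacent differences vanish, the last entry (λ_L itself) excluded.
NoAdjacentZeros : List ℕ → Set
NoAdjacentZeros (x ∷ y ∷ z ∷ r) = ¬ (x ≡ 0 × y ≡ 0) × NoAdjacentZeros (y ∷ z ∷ r)
NoAdjacentZeros _               = ⊤

NoAdjacentZeros? : ∀ ds → Dec (NoAdjacentZeros ds)
NoAdjacentZeros? (x ∷ y ∷ z ∷ r) = ¬? ((x ℕ.≟ 0) ×-dec (y ℕ.≟ 0)) ×-dec NoAdjacentZeros? (y ∷ z ∷ r)
NoAdjacentZeros? []              = yes tt
NoAdjacentZeros? (x ∷ [])        = yes tt
NoAdjacentZeros? (x ∷ y ∷ [])    = yes tt

HeadNotDoubleZero : List ℕ → Set
HeadNotDoubleZero (x ∷ y ∷ z ∷ r) = ¬ (x ≡ 0 × y ≡ 0)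
HeadNotDoubleZero _               = ⊤

NoAdjacentZeros-∷⁻ : ∀ d ds → NoAdjacentZeros (d ∷ ds) → HeadNotDoubleZero (d ∷ ds) × NoAdjacentZeros ds
NoAdjacentZeros-∷⁻ d []          _ = tt , tt
NoAdjacentZeros-∷⁻ d (y ∷ [])    _ = tt , tt
NoAdjacentZeros-∷⁻ d (y ∷ z ∷ r) p = p

NoAdjacentZeros-∷⁺ : ∀ d ds → HeadNotDoubleZero (d ∷ ds) → NoAdjacentZeros ds → NoAdjacentZeros (d ∷ ds)
NoAdjacentZeros-∷⁺ d []          _ _ = tt
NoAdjacentZeros-∷⁺ d (y ∷ [])    _ _ = tt
NoAdjacentZeros-∷⁺ d (y ∷ z ∷ r) h t = h , t

occ-∷ : ∀ y x xs → occ y (x ∷ xs) ≡ indicator (y ℕ.≟ x) + occ y xs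
occ-∷ y x xs = count-∷ (y ℕ.≟_) x xs

occ-here : ∀ x xs → occ x (x ∷ xs) ≡ suc (occ x xs)
occ-here x xs rewrite occ-∷ x x xs | dec-true (x ℕ.≟ x) refl = refl

occ-there : ∀ y x xs → y ≢ x → occ y (x ∷ xs) ≡ occ y xs
occ-there y x xs y≢x rewrite occ-∷ y x xs | dec-false (y ℕ.≟ x) y≢x = refl

occ-mono : ∀ y x xs → occ y xs ≤ occ y (x ∷ xs)
occ-mono y x xs rewrite occ-∷ y x xs = ℕ.m≤n+m (occ y xs) _

occ-absent : ∀ y zs → All (_< y) zs → occ y zs ≡ 0
occ-absent y []       _        = refl
occ-absent y (z ∷ zs) (z<y ∷ ps) = trans (occ-there y z zs (λ y≡z → ℕ.<-irrefl (sym y≡z) z<y)) (occ-absent y zs ps)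

AtMostTwice : List ℕ → Set
AtMostTwice xs = All (λ y → occ y xs ≤ 2) xs

AtMostTwice-∷⁻ : ∀ x xs → AtMostTwice (x ∷ xs) → occ x (x ∷ xs) ≤ 2 × AtMostTwice xs
AtMostTwice-∷⁻ x xs (p ∷ ps) = p , All.map (λ {y} q → ℕ.≤-trans (occ-mono y x xs) q) ps

AtMostTwice-∷⁺ : ∀ x xs → occ x (x ∷ xs) ≤ 2 → AtMostTwice xs → AtMostTwice (x ∷ xs)
AtMostTwice-∷⁺ x xs p ps = p ∷ All.map bound ps
  where
  bound : ∀ {y} → occ y xs ≤ 2 → occ y (x ∷ xs) ≤ 2
  bound {y} q with y ℕ.≟ x
  ... | yes refl = p
  ... | no  y≢x  = subst (_≤ 2) (sym (occ-there y x xs y≢x)) q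

All-suffixSums-≤ : ∀ ds → All (_≤ sum ds) (suffixSums ds)
All-suffixSums-≤ []       = []
All-suffixSums-≤ (d ∷ ds) = ℕ.≤-refl ∷ All.map (λ q → ℕ.≤-trans q (ℕ.m≤n+m _ d)) (All-suffixSums-≤ ds)

All-suffixSums-< : ∀ ds y → sum ds < y → All (_< y) (suffixSums ds)
All-suffixSums-< ds y Σ<y = All.map (λ q → ℕ.≤-<-trans q Σ<y) (All-suffixSums-≤ ds)

occ-head⇒HeadNotDoubleZero : ∀ d ds → occ (d + sum ds) ((d + sum ds) ∷ suffixSums ds) ≤ 2 → HeadNotDoubleZero (d ∷ ds)
occ-head⇒HeadNotDoubleZero d       []                  _ = tt
occ-head⇒HeadNotDoubleZero d       (d′ ∷ [])           _ = tt
occ-head⇒HeadNotDoubleZero zero    (zero ∷ r₀ ∷ r) occ≤2 (_ , _)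
  rewrite occ-here (sum (r₀ ∷ r)) (suffixSums (zero ∷ r₀ ∷ r)) | occ-here (sum (r₀ ∷ r)) (suffixSums (r₀ ∷ r))
        | occ-here (sum (r₀ ∷ r)) (suffixSums r) = ℕ.<-irrefl refl (ℕ.≤-trans (s≤s (s≤s (s≤s z≤n))) occ≤2)
occ-head⇒HeadNotDoubleZero zero    (suc d′ ∷ r₀ ∷ r) _ (_ , ())
occ-head⇒HeadNotDoubleZero (suc d) (d′ ∷ r₀ ∷ r)     _ (() , _)

HeadNotDoubleZero⇒occ-head : ∀ d ds → HeadNotDoubleZero (d ∷ ds) → occ (d + sum ds) ((d + sum ds) ∷ suffixSums ds) ≤ 2
HeadNotDoubleZero⇒occ-head d ds h = subst (_≤ 2) (sym (occ-here _ (suffixSums ds))) (s≤s (occ-tail d ds h))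
  where
  occ-tail : ∀ d ds → HeadNotDoubleZero (d ∷ ds) → occ (d + sum ds) (suffixSums ds) ≤ 1
  occ-tail d       []              _ = z≤n
  occ-tail (suc d) ds              _ =
    subst (_≤ 1) (sym (occ-absent _ (suffixSums ds) (All-suffixSums-< ds _ (s≤s (ℕ.m≤n+m (sum ds) d))))) z≤n
  occ-tail zero    (suc d′ ∷ r)    _ rewrite occ-here (suc d′ + sum r) (suffixSums r) =
    s≤s (ℕ.≤-reflexive (occ-absent _ (suffixSums r) (All-suffixSums-< r _ (s≤s (ℕ.m≤n+m (sum r) d′)))))
  occ-tail zero    (zero ∷ [])     _ = s≤s z≤n
  occ-tail zero    (zero ∷ r₀ ∷ r) h = ⊥-elim (h (refl , refl))

AtMostTwice-suffixSums⁻ : ∀ ds → AtMostTwice (suffixSums ds) → NoAdjacentZeros ds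
AtMostTwice-suffixSums⁻ []       _ = tt
AtMostTwice-suffixSums⁻ (d ∷ ds) twice with AtMostTwice-∷⁻ _ (suffixSums ds) twice
... | head , tail = NoAdjacentZeros-∷⁺ d ds (occ-head⇒HeadNotDoubleZero d ds head) (AtMostTwice-suffixSums⁻ ds tail)

AtMostTwice-suffixSums⁺ : ∀ ds → NoAdjacentZeros ds → AtMostTwice (suffixSums ds)
AtMostTwice-suffixSums⁺ []       _ = []
AtMostTwice-suffixSums⁺ (d ∷ ds) nz with NoAdjacentZeros-∷⁻ d ds nz
... | head , tail = AtMostTwice-∷⁺ _ (suffixSums ds) (HeadNotDoubleZero⇒occ-head d ds head) (AtMostTwice-suffixSums⁺ ds tail)

DiffCondition : ℕ → ℕ → ℤ → List ℕ → Set
DiffCondition L N m ds =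
  length ds ≡ L × LastPositive ds × NoAdjacentZeros ds × middleSum ds ≡ 2 × middleOnes ds ≡ 2 ×
  weightedSum 0 ds ≡ N × + firstSum ds ≡ m

DiffCondition? : ∀ L N m ds → Dec (DiffCondition L N m ds)
DiffCondition? L N m ds =
  (length ds ℕ.≟ L) ×-dec LastPositive? ds ×-dec NoAdjacentZeros? ds ×-dec (middleSum ds ℕ.≟ 2) ×-dec
  (middleOnes ds ℕ.≟ 2) ×-dec (weightedSum 0 ds ℕ.≟ N) ×-dec (+ firstSum ds ℤ.≟ m)

count-LHSCond≡count-DiffCondition : ∀ L N m →
  count (LHSCond? L N m) (allLists L N) ≡ count (DiffCondition? L N m) (allLists L N)
count-LHSCond≡count-DiffCondition L N m = count-differences L N (LHSCond? L N m) (DiffCondition? L N m) forth back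
  where
  forth : ∀ xs → length xs ≡ L → All (_≤ N) xs → LHSCond L N m xs → DiffCondition L N m (differences xs) × Linked _≥_ xs
  forth xs _ _ ((len , pos , xs↓ , sum≡) , (twice , Σ₂≡ , gap1≡) , Σ₁≡) =
    ( trans (length-differences xs) len
    , All-positive⇒LastPositive ds (subst (All (1 ≤_)) (sym xs≡) pos)
    , AtMostTwice-suffixSums⁻ ds (subst AtMostTwice (sym xs≡) twice)
    , ℤ.+-injective (trans (sym (Σ₂-suffixSums ds)) (trans (cong Σ₂ xs≡) Σ₂≡))
    , trans (sym (unitsGap1-suffixSums ds)) (trans (cong unitsGap1 xs≡) gap1≡)
    , trans (sym (sum-suffixSums ds)) (trans (cong sum xs≡) sum≡)
    , trans (sym (Σ₁-suffixSums ds)) (trans (cong Σ₁ xs≡) Σ₁≡) ) , xs↓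
    where
    ds = differences xs
    xs≡ = suffixSums-differences xs xs↓
  back : ∀ ds → length ds ≡ L → All (_≤ N) ds → DiffCondition L N m ds →
    LHSCond L N m (suffixSums ds) × All (_≤ N) (suffixSums ds)
  back ds _ _ (len , lastPos , nz , middle≡ , ones≡ , weight≡ , first≡) =
    ( ( trans (length-suffixSums ds) len , LastPositive⇒All-positive ds lastPos , suffixSums-nonincreasing ds , sum≡)
    , ( AtMostTwice-suffixSums⁺ ds nz , trans (Σ₂-suffixSums ds) (cong +_ middle≡) , trans (unitsGap1-suffixSums ds) ones≡)
    , trans (Σ₁-suffixSums ds) first≡ )
    , subst (λ t → All (_≤ t) (suffixSums ds)) sum≡ (All-≤-sum (suffixSums ds))
    where
    sum≡ = trans (sum-suffixSums ds) weight≡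

-- Shapes of admissible difference vectors

Block : Set
Block = Constraint × Constraint × Constraint

Shape : Set
Shape = List Block × Constraint × Constraint

-- The coordinate in position k + i (1-based) has q-weight k + i; the first coordinate of each
-- basic unit has z-weight 1 (weightedSum 0 and firstSum as a slot list).
blockSlots : ℕ → List Block → List Slot
blockSlots k []                   = []
blockSlots k ((c₁ , c₂ , c₃) ∷ bs) =
  (c₁ , suc k , 1) ∷ (c₂ , suc (suc k) , 0) ∷ (c₃ , suc (suc (suc k)) , 0) ∷ blockSlots (suc (suc (suc k))) bs

pairSlots : ℕ → Constraint × Constraint → List Slot
pairSlots k (f₁ , f₂) = (f₁ , suc k , 1) ∷ (f₂ , suc (suc k) , 0) ∷ []

offset : ℕ → ℕ → ℕ
offset k zero    = k
offset k (suc i) = offset (suc (suc (suc k))) i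

shapeSlots : ℕ → Shape → List Slot
shapeSlots k (bs , F) = blockSlots k bs ++ pairSlots (offset k (length bs)) F

zeroUnit oneUnit lastOneUnit lastOneUnit₀ : Block
zeroUnit     = (atLeast 1 , exactly 0 , atLeast 1)
oneUnit      = (atLeast 0 , exactly 1 , atLeast 0)
lastOneUnit  = (atLeast 0 , exactly 1 , atLeast 1)
lastOneUnit₀ = (atLeast 0 , exactly 1 , exactly 0)

finalPair finalPair⁺ : Constraint × Constraint
finalPair  = (atLeast 0 , exactly 1)
finalPair⁺ = (atLeast 1 , exactly 1)

consZeroUnit : Shape → Shape
consZeroUnit (bs , F) = (zeroUnit ∷ bs , F)

-- The shapes whose first basic unit is the one with λ₃ᵢ₋₁ − λ₃ᵢ = 1 other than the final pair.
-- A last unit ending in a zero difference forces the next difference to be positive.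
oneUnitShapes : ℕ → List Shape
oneUnitShapes zero    = (lastOneUnit ∷ [] , finalPair) ∷ (lastOneUnit₀ ∷ [] , finalPair⁺) ∷ []
oneUnitShapes (suc n) = (oneUnit ∷ replicate (suc n) zeroUnit , finalPair) ∷ []

shapes : ℕ → List Shape
shapes zero    = []
shapes (suc n) = map consZeroUnit (shapes n) ++ oneUnitShapes n

length3n+2 : ℕ → ℕ
length3n+2 zero    = 2
length3n+2 (suc n) = suc (suc (suc (length3n+2 n)))

Admissible : ℕ → ℕ → ℕ → List ℕ → Set
Admissible σ γ n ds =
  length ds ≡ length3n+2 n × LastPositive ds × NoAdjacentZeros ds × middleSum ds ≡ σ × middleOnes ds ≡ γ

Admissible? : ∀ σ γ n ds → Dec (Admissible σ γ n ds)
Admissible? σ γ n ds =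
  (length ds ℕ.≟ length3n+2 n) ×-dec LastPositive? ds ×-dec NoAdjacentZeros? ds ×-dec
  (middleSum ds ℕ.≟ σ) ×-dec (middleOnes ds ℕ.≟ γ)

length3n+2≢0 : ∀ {n} → 0 ≢ length3n+2 n
length3n+2≢0 {zero}  ()
length3n+2≢0 {suc n} ()

length3n+2≢1 : ∀ {n} → 1 ≢ length3n+2 n
length3n+2≢1 {zero}  ()
length3n+2≢1 {suc n} ()

length3n+2-suc⁻ : ∀ (r : List ℕ) n → suc (suc (suc (length r))) ≡ length3n+2 (suc n) → length r ≡ length3n+2 n
length3n+2-suc⁻ r n = ℕ.suc-injective ∘ ℕ.suc-injective ∘ ℕ.suc-injective

middleSum-positive : ∀ n ds → length ds ≡ length3n+2 n → LastPositive ds → 1 ≤ middleSum ds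
middleSum-positive zero    (x ∷ y ∷ [])          _   lp = lp
middleSum-positive (suc n) (a ∷ b ∷ c ∷ x ∷ r)   len lp =
  ℕ.≤-trans (middleSum-positive n (x ∷ r) (length3n+2-suc⁻ (x ∷ r) n len) lp) (ℕ.m≤n+m _ b)
middleSum-positive (suc n) (a ∷ b ∷ c ∷ [])      len _  = ⊥-elim (length3n+2≢0 (length3n+2-suc⁻ [] n len))

-- The final difference λ_L is already ≥ 1, so Σ₂ = 1 forces every middle difference of a unit to vanish.
zeroUnits-fits : ∀ n k ds → Admissible 1 1 n ds → Fits (shapeSlots k (replicate n zeroUnit , finalPair)) ds
zeroUnits-fits zero    k (x ∷ y ∷ [])                    (_ , _ , _ , middle≡1 , _) = z≤n , middle≡1 , tt
zeroUnits-fits (suc n) k (a ∷ zero ∷ c ∷ x ∷ y ∷ r) (len , lp , (¬a,b≡0 , ¬b,c≡0 , nz) , middle≡ , ones≡) =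
  ℕ.n≢0⇒n>0 (λ a≡0 → ¬a,b≡0 (a≡0 , refl)) , refl , ℕ.n≢0⇒n>0 (λ c≡0 → ¬b,c≡0 (refl , c≡0)) ,
  zeroUnits-fits n _ (x ∷ y ∷ r) (length3n+2-suc⁻ (x ∷ y ∷ r) n len , lp , proj₂ nz , middle≡ , ones≡)
zeroUnits-fits (suc n) k (a ∷ suc b ∷ c ∷ x ∷ y ∷ r) (len , lp , _ , middle≡ , _) =
  ⊥-elim (ℕ.<⇒≢ (s≤s (ℕ.≤-trans (middleSum-positive n (x ∷ y ∷ r) (length3n+2-suc⁻ (x ∷ y ∷ r) n len) lp)
                                (ℕ.m≤n+m _ b)))
                (sym middle≡))
zeroUnits-fits zero    k []                    (() , _)
zeroUnits-fits zero    k (x ∷ [])              (() , _)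
zeroUnits-fits zero    k (x ∷ y ∷ z ∷ r)       (() , _)
zeroUnits-fits (suc n) k []                    (() , _)
zeroUnits-fits (suc n) k (a ∷ [])              (() , _)
zeroUnits-fits (suc n) k (a ∷ b ∷ [])          (() , _)
zeroUnits-fits (suc n) k (a ∷ b ∷ c ∷ [])      (len , _) = ⊥-elim (length3n+2≢0 (length3n+2-suc⁻ [] n len))
zeroUnits-fits (suc n) k (a ∷ b ∷ c ∷ x ∷ []) (len , _) = ⊥-elim (length3n+2≢1 (length3n+2-suc⁻ (x ∷ []) n len))

Fits-[] : ∀ k s → ¬ Fits (shapeSlots k s) []
Fits-[] k ([]    , F) ()
Fits-[] k (_ ∷ _ , F) ()

zeroUnits-admissible : ∀ n k ds → Fits (shapeSlots k (replicate n zeroUnit , finalPair)) ds → Admissible 1 1 n ds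
zeroUnits-admissible zero    k (x ∷ y ∷ []) (_ , refl , _) = refl , s≤s z≤n , tt , refl , refl
zeroUnits-admissible (suc n) k (a ∷ b ∷ c ∷ r) (1≤a , refl , 1≤c , fits) with zeroUnits-admissible n _ r fits
... | len , lp , nz , middle≡ , ones≡ with r
...   | x ∷ y ∷ r′ =
  cong (suc ∘ suc ∘ suc) len , lp ,
  ((λ (a≡0 , _) → ℕ.<-irrefl (sym a≡0) 1≤a) , (λ (_ , c≡0) → ℕ.<-irrefl (sym c≡0) 1≤c) ,
   (λ (c≡0 , _) → ℕ.<-irrefl (sym c≡0) 1≤c) , nz) , middle≡ , ones≡
...   | x ∷ [] = ⊥-elim (length3n+2≢1 len)
...   | []     = ⊥-elim (Fits-[] _ (replicate n zeroUnit , finalPair) fits)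

fitCount : ℕ → List Shape → List ℕ → ℕ
fitCount k ss ds = sum (map (λ s → indicator (Fits? (shapeSlots k s) ds)) ss)

fitCount-++ : ∀ k ss ss′ ds → fitCount k (ss ++ ss′) ds ≡ fitCount k ss ds + fitCount k ss′ ds
fitCount-++ k ss ss′ ds = trans (cong sum (List.map-++ f ss ss′)) (sum-++ (map f ss) (map f ss′))
  where
  f : Shape → ℕ
  f s = indicator (Fits? (shapeSlots k s) ds)

fitCount-none : ∀ k ss ds → All (λ s → ¬ Fits (shapeSlots k s) ds) ss → fitCount k ss ds ≡ 0
fitCount-none k []       ds []               = refl
fitCount-none k (s ∷ ss) ds (¬fits ∷ ¬fitss)
  rewrite indicator-no (Fits? (shapeSlots k s) ds) ¬fits = fitCount-none k ss ds ¬fitss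

fitCount-consZeroUnit : ∀ k ss a c r →
  fitCount k (map consZeroUnit ss) (suc a ∷ 0 ∷ suc c ∷ r) ≡ fitCount (suc (suc (suc k))) ss r
fitCount-consZeroUnit k []       a c r = refl
fitCount-consZeroUnit k (s ∷ ss) a c r = cong (λ t → _ + t) (fitCount-consZeroUnit k ss a c r)

consZeroUnit-misfit : ∀ k ss a b c r → ¬ (1 ≤ a × b ≡ 0 × 1 ≤ c) →
  fitCount k (map consZeroUnit ss) (a ∷ b ∷ c ∷ r) ≡ 0
consZeroUnit-misfit k ss a b c r ¬unit =
  fitCount-none k _ _ (All.map⁺ (All.universal (λ _ (1≤a , b≡0 , 1≤c , _) → ¬unit (1≤a , b≡0 , 1≤c)) ss))

oneUnitShapes-misfit : ∀ n k a b c r → b ≢ 1 → fitCount k (oneUnitShapes n) (a ∷ b ∷ c ∷ r) ≡ 0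
oneUnitShapes-misfit n k a b c r b≢1 = fitCount-none k (oneUnitShapes n) _ (misfit n)
  where
  misfit : ∀ n → All (λ s → ¬ Fits (shapeSlots k s) (a ∷ b ∷ c ∷ r)) (oneUnitShapes n)
  misfit zero    = (λ (_ , b≡1 , _) → b≢1 b≡1) ∷ (λ (_ , b≡1 , _) → b≢1 b≡1) ∷ []
  misfit (suc n) = (λ (_ , b≡1 , _) → b≢1 b≡1) ∷ []

oneUnit-admissible⁻ : ∀ n a c x y r → Admissible 2 2 (suc n) (a ∷ 1 ∷ c ∷ x ∷ y ∷ r) →
  Admissible 1 1 n (x ∷ y ∷ r) × ¬ (c ≡ 0 × x ≡ 0)
oneUnit-admissible⁻ n a c x y r (len , lp , (_ , _ , ¬c,x≡0 , nz) , middle≡ , ones≡) =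
  (length3n+2-suc⁻ (x ∷ y ∷ r) n len , lp , nz , ℕ.suc-injective middle≡ , ℕ.suc-injective ones≡) , ¬c,x≡0

oneUnit-admissible⁺ : ∀ n a c x y r → Admissible 1 1 n (x ∷ y ∷ r) → ¬ (c ≡ 0 × x ≡ 0) →
  Admissible 2 2 (suc n) (a ∷ 1 ∷ c ∷ x ∷ y ∷ r)
oneUnit-admissible⁺ n a c x y r (len , lp , nz , middle≡ , ones≡) ¬c,x≡0 =
  cong (suc ∘ suc ∘ suc) len , lp , ((λ ()) ∘ proj₂ , (λ ()) ∘ proj₁ , ¬c,x≡0 , nz) , cong suc middle≡ , cong suc ones≡

indicator-lastOneUnit : ∀ k a c x y →
  indicator (Admissible? 2 2 1 (a ∷ 1 ∷ suc c ∷ x ∷ y ∷ []))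
    ≡ indicator (Fits? (shapeSlots k (lastOneUnit ∷ [] , finalPair)) (a ∷ 1 ∷ suc c ∷ x ∷ y ∷ []))
indicator-lastOneUnit k a c x y = indicator-⇔ (Admissible? 2 2 1 ds) (Fits? (shapeSlots k shape) ds) forth back
  where
  ds = a ∷ 1 ∷ suc c ∷ x ∷ y ∷ []
  shape = (lastOneUnit ∷ [] , finalPair)
  forth : Admissible 2 2 1 ds → Fits (shapeSlots k shape) ds
  forth (_ , _ , _ , middle≡ , _) = z≤n , refl , s≤s z≤n , z≤n , ℕ.suc-injective middle≡ , tt
  back : Fits (shapeSlots k shape) ds → Admissible 2 2 1 ds
  back (_ , _ , _ , _ , refl , _) = refl , s≤s z≤n , ((λ ()) ∘ proj₂ , (λ ()) ∘ proj₁ , (λ ()) ∘ proj₁ , tt) , refl , refl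

indicator-lastOneUnit₀ : ∀ k a x y →
  indicator (Admissible? 2 2 1 (a ∷ 1 ∷ 0 ∷ x ∷ y ∷ []))
    ≡ indicator (Fits? (shapeSlots k (lastOneUnit₀ ∷ [] , finalPair⁺)) (a ∷ 1 ∷ 0 ∷ x ∷ y ∷ []))
indicator-lastOneUnit₀ k a x y = indicator-⇔ (Admissible? 2 2 1 ds) (Fits? (shapeSlots k shape) ds) forth back
  where
  ds = a ∷ 1 ∷ 0 ∷ x ∷ y ∷ []
  shape = (lastOneUnit₀ ∷ [] , finalPair⁺)
  forth : Admissible 2 2 1 ds → Fits (shapeSlots k shape) ds
  forth (_ , _ , (_ , _ , ¬c,x≡0 , _) , middle≡ , _) =
    z≤n , refl , refl , ℕ.n≢0⇒n>0 (λ x≡0 → ¬c,x≡0 (refl , x≡0)) , ℕ.suc-injective middle≡ , tt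
  back : Fits (shapeSlots k shape) ds → Admissible 2 2 1 ds
  back (_ , _ , _ , 1≤x , refl , _) =
    refl , s≤s z≤n , ((λ ()) ∘ proj₂ , (λ ()) ∘ proj₁ , (λ (_ , x≡0) → ℕ.<-irrefl (sym x≡0) 1≤x) , tt) , refl , refl

indicator-oneUnit : ∀ n k a c x y r → length (x ∷ y ∷ r) ≡ length3n+2 n →
  indicator (Admissible? 2 2 (suc n) (a ∷ 1 ∷ c ∷ x ∷ y ∷ r)) ≡ fitCount k (oneUnitShapes n) (a ∷ 1 ∷ c ∷ x ∷ y ∷ r)
indicator-oneUnit zero k a (suc c) x y [] _ =
  trans (indicator-lastOneUnit k a c x y)
        (sym (trans (cong (λ t → indicator (Fits? (shapeSlots k (lastOneUnit ∷ [] , finalPair)) ds) + (t + 0))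
                          (indicator-no (Fits? (shapeSlots k (lastOneUnit₀ ∷ [] , finalPair⁺)) ds) λ { (_ , _ , () , _) }))
                    (ℕ.+-identityʳ _)))
  where ds = a ∷ 1 ∷ suc c ∷ x ∷ y ∷ []
indicator-oneUnit zero k a zero x y [] _ =
  trans (indicator-lastOneUnit₀ k a x y)
        (sym (trans (cong (λ t → t + (indicator (Fits? (shapeSlots k (lastOneUnit₀ ∷ [] , finalPair⁺)) ds) + 0))
                          (indicator-no (Fits? (shapeSlots k (lastOneUnit ∷ [] , finalPair)) ds) λ { (_ , _ , () , _) }))
                    (ℕ.+-identityʳ _)))
  where ds = a ∷ 1 ∷ 0 ∷ x ∷ y ∷ []
indicator-oneUnit zero    k a c x y (_ ∷ _) ()
indicator-oneUnit (suc n) k a c x y r _ =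
  trans (indicator-⇔ (Admissible? 2 2 (suc (suc n)) ds) (Fits? (shapeSlots k shape) ds) forth back)
        (sym (ℕ.+-identityʳ _))
  where
  ds = a ∷ 1 ∷ c ∷ x ∷ y ∷ r
  shape = (oneUnit ∷ replicate (suc n) zeroUnit , finalPair)
  forth : Admissible 2 2 (suc (suc n)) ds → Fits (shapeSlots k shape) ds
  forth adm = z≤n , refl , z≤n , zeroUnits-fits (suc n) _ (x ∷ y ∷ r) (proj₁ (oneUnit-admissible⁻ (suc n) a c x y r adm))
  back : Fits (shapeSlots k shape) ds → Admissible 2 2 (suc (suc n)) ds
  back (_ , _ , _ , fits) = oneUnit-admissible⁺ (suc n) a c x y r (zeroUnits-admissible (suc n) _ (x ∷ y ∷ r) fits)
                              (λ (_ , x≡0) → ℕ.<-irrefl (sym x≡0) (proj₁ fits))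

zeroUnit-admissible⁻ : ∀ n a c x y r →
  Admissible 2 2 (suc n) (suc a ∷ 0 ∷ suc c ∷ x ∷ y ∷ r) → Admissible 2 2 n (x ∷ y ∷ r)
zeroUnit-admissible⁻ n a c x y r (len , lp , (_ , _ , _ , nz) , middle≡ , ones≡) =
  length3n+2-suc⁻ (x ∷ y ∷ r) n len , lp , nz , middle≡ , ones≡

zeroUnit-admissible⁺ : ∀ n a c x y r →
  Admissible 2 2 n (x ∷ y ∷ r) → Admissible 2 2 (suc n) (suc a ∷ 0 ∷ suc c ∷ x ∷ y ∷ r)
zeroUnit-admissible⁺ n a c x y r (len , lp , nz , middle≡ , ones≡) =
  cong (suc ∘ suc ∘ suc) len , lp , ((λ ()) ∘ proj₁ , (λ ()) ∘ proj₂ , (λ ()) ∘ proj₁ , nz) , middle≡ , ones≡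

-- Each admissible difference vector fits exactly one shape: the shape records the position of the
-- basic unit with λ₃ᵢ₋₁ − λ₃ᵢ = 1 and, when it is the last full unit, whether λ₃ᵢ > λ₃ᵢ₊₁.
indicator-Admissible≡fitCount : ∀ n k ds → length ds ≡ length3n+2 n →
  indicator (Admissible? 2 2 n ds) ≡ fitCount k (shapes n) ds

indicator-Admissible-firstUnit : ∀ n k a b c x y r → length (x ∷ y ∷ r) ≡ length3n+2 n →
  indicator (Admissible? 2 2 (suc n) (a ∷ b ∷ c ∷ x ∷ y ∷ r))
    ≡ fitCount k (map consZeroUnit (shapes n)) (a ∷ b ∷ c ∷ x ∷ y ∷ r) + fitCount k (oneUnitShapes n) (a ∷ b ∷ c ∷ x ∷ y ∷ r)
indicator-Admissible-firstUnit n k zero zero c x y r _ =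
  trans (indicator-no (Admissible? 2 2 (suc n) (0 ∷ 0 ∷ c ∷ x ∷ y ∷ r)) λ (_ , _ , (¬a,b≡0 , _) , _) → ¬a,b≡0 (refl , refl))
        (sym (cong₂ _+_ (consZeroUnit-misfit k (shapes n) 0 0 c (x ∷ y ∷ r) λ { (() , _) })
                        (oneUnitShapes-misfit n k 0 0 c (x ∷ y ∷ r) λ ())))
indicator-Admissible-firstUnit n k (suc a) zero zero x y r _ =
  trans (indicator-no (Admissible? 2 2 (suc n) (suc a ∷ 0 ∷ 0 ∷ x ∷ y ∷ r)) λ (_ , _ , (_ , ¬b,c≡0 , _) , _) → ¬b,c≡0 (refl , refl))
        (sym (cong₂ _+_ (consZeroUnit-misfit k (shapes n) (suc a) 0 0 (x ∷ y ∷ r) λ { (_ , _ , ()) })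
                        (oneUnitShapes-misfit n k (suc a) 0 0 (x ∷ y ∷ r) λ ())))
indicator-Admissible-firstUnit n k (suc a) zero (suc c) x y r len = begin
  indicator (Admissible? 2 2 (suc n) (suc a ∷ 0 ∷ suc c ∷ r′))
    ≡⟨ indicator-⇔ (Admissible? 2 2 (suc n) (suc a ∷ 0 ∷ suc c ∷ r′)) (Admissible? 2 2 n r′)
         (zeroUnit-admissible⁻ n a c x y r) (zeroUnit-admissible⁺ n a c x y r) ⟩
  indicator (Admissible? 2 2 n r′)
    ≡⟨ indicator-Admissible≡fitCount n (suc (suc (suc k))) r′ len ⟩
  fitCount (suc (suc (suc k))) (shapes n) r′
    ≡⟨ sym (fitCount-consZeroUnit k (shapes n) a c r′) ⟩
  fitCount k (map consZeroUnit (shapes n)) (suc a ∷ 0 ∷ suc c ∷ r′)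
    ≡⟨ sym (ℕ.+-identityʳ _) ⟩
  fitCount k (map consZeroUnit (shapes n)) (suc a ∷ 0 ∷ suc c ∷ r′) + 0
    ≡⟨ cong (λ t → fitCount k (map consZeroUnit (shapes n)) (suc a ∷ 0 ∷ suc c ∷ r′) + t)
            (sym (oneUnitShapes-misfit n k (suc a) 0 (suc c) r′ λ ())) ⟩
  fitCount k (map consZeroUnit (shapes n)) (suc a ∷ 0 ∷ suc c ∷ r′) + fitCount k (oneUnitShapes n) (suc a ∷ 0 ∷ suc c ∷ r′) ∎
  where
  open ≡-Reasoning
  r′ = x ∷ y ∷ r
indicator-Admissible-firstUnit n k a (suc zero) c x y r len =
  trans (indicator-oneUnit n k a c x y r len)
        (sym (cong (_+ fitCount k (oneUnitShapes n) (a ∷ 1 ∷ c ∷ x ∷ y ∷ r)) (consZeroUnit-misfit k (shapes n) a 1 c (x ∷ y ∷ r) λ { (_ , () , _) })))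
indicator-Admissible-firstUnit n k a (suc (suc b)) c x y r len =
  trans (indicator-no (Admissible? 2 2 (suc n) (a ∷ suc (suc b) ∷ c ∷ x ∷ y ∷ r)) λ (_ , lp , _ , middle≡ , _) → middle>2 lp middle≡)
        (sym (cong₂ _+_ (consZeroUnit-misfit k (shapes n) a (suc (suc b)) c (x ∷ y ∷ r) λ { (_ , () , _) })
                        (oneUnitShapes-misfit n k a (suc (suc b)) c (x ∷ y ∷ r) λ ())))
  where
  middle>2 : LastPositive (x ∷ y ∷ r) → suc (suc b) + middleSum (x ∷ y ∷ r) ≢ 2
  middle>2 lp middle≡ = ℕ.<⇒≢ (s≤s (s≤s (ℕ.≤-trans (middleSum-positive n (x ∷ y ∷ r) len lp) (ℕ.m≤n+m _ b))))
                              (sym middle≡)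

indicator-Admissible≡fitCount zero k (x ∷ y ∷ []) _ =
  indicator-no (Admissible? 2 2 0 (x ∷ y ∷ [])) λ (_ , _ , _ , y≡2 , ones≡2) → isOne-2 y y≡2 ones≡2
  where
  isOne-2 : ∀ y → y ≡ 2 → isOne y ≢ 2
  isOne-2 .2 refl ()
indicator-Admissible≡fitCount (suc n) k (a ∷ b ∷ c ∷ x ∷ y ∷ r) len =
  trans (indicator-Admissible-firstUnit n k a b c x y r (length3n+2-suc⁻ (x ∷ y ∷ r) n len))
        (sym (fitCount-++ k (map consZeroUnit (shapes n)) (oneUnitShapes n) (a ∷ b ∷ c ∷ x ∷ y ∷ r)))
indicator-Admissible≡fitCount (suc n) k (a ∷ b ∷ c ∷ [])     len = ⊥-elim (length3n+2≢0 (length3n+2-suc⁻ [] n len))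
indicator-Admissible≡fitCount (suc n) k (a ∷ b ∷ c ∷ x ∷ []) len = ⊥-elim (length3n+2≢1 (length3n+2-suc⁻ (x ∷ []) n len))

qDegree-shapeSlots : ∀ k s ds → Fits (shapeSlots k s) ds → qDegree (shapeSlots k s) ds ≡ weightedSum k ds
qDegree-shapeSlots k ([] , F) (x ∷ y ∷ []) _ = refl
qDegree-shapeSlots k ((c₁ , c₂ , c₃) ∷ bs , F) (a ∷ b ∷ c ∷ r) (_ , _ , _ , fits) =
  cong (λ t → suc k * a + (suc (suc k) * b + (suc (suc (suc k)) * c + t))) (qDegree-shapeSlots _ (bs , F) r fits)

zDegree-shapeSlots : ∀ k s ds → Fits (shapeSlots k s) ds → zDegree (shapeSlots k s) ds ≡ firstSum ds
zDegree-shapeSlots k ([] , F) (x ∷ y ∷ []) _ = trans (ℕ.+-identityʳ _) (ℕ.+-identityʳ x)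
zDegree-shapeSlots k ((c₁ , c₂ , c₃) ∷ bs , F) (a ∷ b ∷ c ∷ r) (_ , _ , _ , fits) =
  cong₂ _+_ (ℕ.+-identityʳ a) (zDegree-shapeSlots _ (bs , F) r fits)

length-shapeSlots : ∀ k s → length (shapeSlots k s) ≡ length3n+2 (length (proj₁ s))
length-shapeSlots k ([] , F)                  = refl
length-shapeSlots k ((c₁ , c₂ , c₃) ∷ bs , F) = cong (suc ∘ suc ∘ suc) (length-shapeSlots _ (bs , F))

shapeSlots-positive : ∀ k s → All PositiveWeight (shapeSlots k s)
shapeSlots-positive k ([] , F)                  = s≤s z≤n ∷ s≤s z≤n ∷ []
shapeSlots-positive k ((c₁ , c₂ , c₃) ∷ bs , F) = s≤s z≤n ∷ s≤s z≤n ∷ s≤s z≤n ∷ shapeSlots-positive _ (bs , F)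

shapes-units : ∀ n → All (λ s → length (proj₁ s) ≡ n) (shapes n)
shapes-units zero    = []
shapes-units (suc n) = All.++⁺ (All.map⁺ (All.map (cong suc) (shapes-units n))) (oneUnitShapes-units n)
  where
  oneUnitShapes-units : ∀ n → All (λ s → length (proj₁ s) ≡ suc n) (oneUnitShapes n)
  oneUnitShapes-units zero    = refl ∷ refl ∷ []
  oneUnitShapes-units (suc n) = cong (suc ∘ suc) (List.length-replicate n) ∷ []

HasDegrees : ℕ → ℤ → List ℕ → Set
HasDegrees N m ds = weightedSum 0 ds ≡ N × + firstSum ds ≡ m

HasDegrees? : ∀ N m ds → Dec (HasDegrees N m ds)
HasDegrees? N m ds = (weightedSum 0 ds ℕ.≟ N) ×-dec (+ firstSum ds ℤ.≟ m)

indicator-DiffCondition : ∀ n N m ds → length ds ≡ length3n+2 n →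
  indicator (DiffCondition? (length3n+2 n) N m ds) ≡ sum (map (λ s → indicator (Solves? (shapeSlots 0 s) N m ds)) (shapes n))
indicator-DiffCondition n N m ds len = begin
  indicator (DiffCondition? (length3n+2 n) N m ds)
    ≡⟨ indicator-⇔ (DiffCondition? (length3n+2 n) N m ds) (Admissible? 2 2 n ds ×-dec HasDegrees? N m ds)
         (λ (a , b , c , d , e , f , g) → (a , b , c , d , e) , (f , g))
         (λ ((a , b , c , d , e) , (f , g)) → (a , b , c , d , e , f , g)) ⟩
  indicator (Admissible? 2 2 n ds ×-dec HasDegrees? N m ds)
    ≡⟨ indicator-× (Admissible? 2 2 n ds) (HasDegrees? N m ds) ⟩
  indicator (Admissible? 2 2 n ds) * degrees
    ≡⟨ cong (_* degrees) (indicator-Admissible≡fitCount n 0 ds len) ⟩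
  fitCount 0 (shapes n) ds * degrees
    ≡⟨ sym (sum-map-*ʳ (λ s → indicator (Fits? (shapeSlots 0 s) ds)) degrees (shapes n)) ⟩
  sum (map (λ s → indicator (Fits? (shapeSlots 0 s) ds) * degrees) (shapes n))
    ≡⟨ cong sum (List.map-cong (λ s → sym (indicator-Solves s)) (shapes n)) ⟩
  sum (map (λ s → indicator (Solves? (shapeSlots 0 s) N m ds)) (shapes n)) ∎
  where
  open ≡-Reasoning
  degrees = indicator (HasDegrees? N m ds)
  indicator-Solves : ∀ s → indicator (Solves? (shapeSlots 0 s) N m ds) ≡ indicator (Fits? (shapeSlots 0 s) ds) * degrees
  indicator-Solves s =
    trans (indicator-⇔ (Solves? (shapeSlots 0 s) N m ds) (Fits? (shapeSlots 0 s) ds ×-dec HasDegrees? N m ds)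
             (λ (fits , q≡ , z≡) → fits , trans (sym (qDegree-shapeSlots 0 s ds fits)) q≡ ,
                                    trans (cong +_ (sym (zDegree-shapeSlots 0 s ds fits))) z≡)
             (λ (fits , q≡ , z≡) → fits , trans (qDegree-shapeSlots 0 s ds fits) q≡ ,
                                    trans (cong +_ (zDegree-shapeSlots 0 s ds fits)) z≡))
          (indicator-× (Fits? (shapeSlots 0 s) ds) (HasDegrees? N m ds))

lhsCoef≡sum-shapeSeries : ∀ n N m →
  lhsCoef (length3n+2 n) (+ N) m ≡ sumℤ (map (λ s → slotSeries (shapeSlots 0 s) N m) (shapes n))
lhsCoef≡sum-shapeSeries n N m = begin
  + count (LHSCond? L N m) (allLists L N)
    ≡⟨ cong +_ (count-LHSCond≡count-DiffCondition L N m) ⟩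
  + count (DiffCondition? L N m) (allLists L N)
    ≡⟨ cong +_ (count-partition (DiffCondition? L N m) (λ s → Solves? (shapeSlots 0 s) N m) (shapes n) (allLists L N)
                  (λ ds ds∈ → indicator-DiffCondition n N m ds (proj₁ (∈-allLists⁻ L N ds ds∈)))) ⟩
  + sum (map (λ s → count (Solves? (shapeSlots 0 s) N m) (allLists L N)) (shapes n))
    ≡⟨ sym (sumℤ-map-+ (λ s → count (Solves? (shapeSlots 0 s) N m) (allLists L N)) (shapes n)) ⟩
  sumℤ (map (λ s → + count (Solves? (shapeSlots 0 s) N m) (allLists L N)) (shapes n))
    ≡⟨ sumℤ-map-cong (All.map shapeCount≡ (shapes-units n)) ⟩
  sumℤ (map (λ s → slotSeries (shapeSlots 0 s) N m) (shapes n)) ∎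
  where
  open ≡-Reasoning
  L = length3n+2 n
  shapeCount≡ : ∀ {s} → length (proj₁ s) ≡ n →
    + count (Solves? (shapeSlots 0 s) N m) (allLists L N) ≡ slotSeries (shapeSlots 0 s) N m
  shapeCount≡ {s} units≡ =
    trans (cong (λ L′ → + count (Solves? (shapeSlots 0 s) N m) (allLists L′ N))
                (sym (trans (length-shapeSlots 0 s) (cong length3n+2 units≡))))
          (solutionCount≡slotSeries (shapeSlots 0 s) (shapeSlots-positive 0 s) N N m ℕ.≤-refl)

-- Normal forms: a monomial times a product of factors 1/(1 − z^a q^b)

lowerBound : Constraint → ℕ
lowerBound (exactly v) = v
lowerBound (atLeast v) = v

zShift qShift : List Slot → ℕ
zShift []                 = 0
zShift ((c , w , u) ∷ es) = u * lowerBound c + zShift es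
qShift []                 = 0
qShift ((c , w , u) ∷ es) = w * lowerBound c + qShift es

openFactors : List Slot → List Factor
openFactors []                         = []
openFactors ((exactly v , w , u) ∷ es) = openFactors es
openFactors ((atLeast v , w , u) ∷ es) = (+ u , w) ∷ openFactors es

NormalForm : ℕ → ℕ → List Factor → Series
NormalForm z q fs = mulMono (+ z) q (divFactors fs one)

mulMono-zero : ∀ s → mulMono (+ 0) 0 s ≗ₛ s
mulMono-zero s N m rewrite dec-true (0 ≤? N) z≤n = cong (s N) (ℤ.+-identityʳ m)

mulMono-mulMono-+ : ∀ a b c d s → mulMono (+ a) b (mulMono (+ c) d s) ≗ₛ mulMono (+ (a + c)) (b + d) s
mulMono-mulMono-+ a b c d s N m =
  trans (mulMono-mulMono (+ a) b (+ c) d s N m) (cong (λ z → mulMono z (b + d) s N m) (sym (ℤ.pos-+ a c)))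

slotSeries-normal : ∀ es → All PositiveWeight es → slotSeries es ≗ₛ NormalForm (zShift es) (qShift es) (openFactors es)
slotSeries-normal []                         _        N m = sym (mulMono-zero one N m)
slotSeries-normal ((exactly v , w , u) ∷ es) (p ∷ ps) N m =
  trans (mulMono-cong (+ (u * v)) (w * v) (slotSeries-normal es ps) N m)
        (mulMono-mulMono-+ (u * v) (w * v) (zShift es) (qShift es) (divFactors (openFactors es) one) N m)
slotSeries-normal ((atLeast v , w , u) ∷ es) (p ∷ ps) N m =
  trans (mulMono-cong (+ (u * v)) (w * v)
           (λ N′ m′ → trans (divFactor-cong (+ u) w (slotSeries-normal es ps) N′ m′)
                            (divFactor-mulMono (+ u) w (+ zShift es) (qShift es) (divFactors (openFactors es) one) p N′ m′)) N m)
        (mulMono-mulMono-+ (u * v) (w * v) (zShift es) (qShift es) (divFactors ((+ u , w) ∷ openFactors es) one) N m)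

offset-≡ : ∀ k i → offset k i ≡ k + 3 * i
offset-≡ k zero    = sym (ℕ.+-identityʳ k)
offset-≡ k (suc i) = trans (offset-≡ (suc (suc (suc k))) i) (identity k i)
  where
  identity : ∀ k i → suc (suc (suc k)) + 3 * i ≡ k + 3 * suc i
  identity = ℕ-Solver.solve-∀

unitFactors : ℕ → ℕ → List Factor
unitFactors k zero    = []
unitFactors k (suc i) = (+ 1 , suc k) ∷ (+ 0 , suc (suc (suc k))) ∷ unitFactors (suc (suc (suc k))) i

oneUnitAt : ℕ → ℕ → Shape
oneUnitAt i r = (replicate i zeroUnit ++ oneUnit ∷ replicate r zeroUnit , finalPair)

lastUnitShape lastUnitShape₀ : ℕ → Shape
lastUnitShape  n = (replicate n zeroUnit ++ lastOneUnit ∷ [] , finalPair)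
lastUnitShape₀ n = (replicate n zeroUnit ++ lastOneUnit₀ ∷ [] , finalPair⁺)

module _ (bs : List Block) (F : Constraint × Constraint) where

  zShift-zeroUnits : ∀ k i → zShift (shapeSlots k (replicate i zeroUnit ++ bs , F)) ≡ i + zShift (shapeSlots (offset k i) (bs , F))
  zShift-zeroUnits k zero    = refl
  zShift-zeroUnits k (suc i) = cong suc (zShift-zeroUnits (suc (suc (suc k))) i)

  qShift-zeroUnits : ∀ k i → qShift (shapeSlots k (replicate i zeroUnit ++ bs , F))
                               ≡ 2 * k * i + 3 * i * i + i + qShift (shapeSlots (offset k i) (bs , F))
  qShift-zeroUnits k zero    = identity k _
    where
    identity : ∀ k q → q ≡ 2 * k * 0 + 3 * 0 * 0 + 0 + q
    identity = ℕ-Solver.solve-∀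
  qShift-zeroUnits k (suc i) rewrite qShift-zeroUnits (suc (suc (suc k))) i = identity k i _
    where
    identity : ∀ k i q → suc k * 1 + (suc (suc k) * 0 + (suc (suc (suc k)) * 1 + (2 * suc (suc (suc k)) * i + 3 * i * i + i + q)))
                         ≡ 2 * k * suc i + 3 * suc i * suc i + suc i + q
    identity = ℕ-Solver.solve-∀

  openFactors-zeroUnits : ∀ k i → openFactors (shapeSlots k (replicate i zeroUnit ++ bs , F))
                                    ≡ unitFactors k i ++ openFactors (shapeSlots (offset k i) (bs , F))
  openFactors-zeroUnits k zero    = refl
  openFactors-zeroUnits k (suc i) = cong (λ t → (+ 1 , suc k) ∷ (+ 0 , suc (suc (suc k))) ∷ t) (openFactors-zeroUnits _ i)

offset-+ : ∀ k i j → offset k (i + j) ≡ offset (offset k i) j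
offset-+ k zero    j = refl
offset-+ k (suc i) j = offset-+ (suc (suc (suc k))) i j

offset-suc : ∀ k i → offset k (suc i) ≡ 3 + offset k i
offset-suc k zero    = refl
offset-suc k (suc i) = offset-suc (suc (suc (suc k))) i

unitFactors-+ : ∀ k i j → unitFactors k (i + j) ≡ unitFactors k i ++ unitFactors (offset k i) j
unitFactors-+ k zero    j = refl
unitFactors-+ k (suc i) j = cong (λ t → (+ 1 , suc k) ∷ (+ 0 , suc (suc (suc k))) ∷ t) (unitFactors-+ _ i j)

gDegree : ℕ → ℕ
gDegree n = 3 * n * n + 4 * n + 1

gFactors hFactors : ℕ → List Factor
gFactors n = unitFactors 0 n ++ (+ 1 , suc (offset 0 n)) ∷ []
hFactors n = unitFactors 0 n ++ (+ 1 , suc (offset 0 n)) ∷ (+ 1 , suc (offset 0 (suc n))) ∷ []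

shapeSeries : Shape → Series
shapeSeries s = slotSeries (shapeSlots 0 s)

shapeSeries-normal : ∀ s → shapeSeries s ≗ₛ NormalForm (zShift (shapeSlots 0 s)) (qShift (shapeSlots 0 s)) (openFactors (shapeSlots 0 s))
shapeSeries-normal s = slotSeries-normal (shapeSlots 0 s) (shapeSlots-positive 0 s)

gFactors-suc : ∀ n → gFactors (suc n)
  ≡ unitFactors 0 n ++ (+ 1 , suc (offset 0 n)) ∷ (+ 0 , 3 + offset 0 n) ∷ (+ 1 , 4 + offset 0 n) ∷ []
gFactors-suc n = begin
  gFactors (suc n)
    ≡⟨ cong gFactors (ℕ.+-comm 1 n) ⟩
  gFactors (n + 1)
    ≡⟨ cong₂ (λ us o → us ++ (+ 1 , suc o) ∷ []) (unitFactors-+ 0 n 1) (offset-+ 0 n 1) ⟩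
  (unitFactors 0 n ++ unitFactors (offset 0 n) 1) ++ (+ 1 , 4 + offset 0 n) ∷ []
    ≡⟨ List.++-assoc (unitFactors 0 n) _ _ ⟩
  unitFactors 0 n ++ (+ 1 , suc (offset 0 n)) ∷ (+ 0 , 3 + offset 0 n) ∷ (+ 1 , 4 + offset 0 n) ∷ [] ∎
  where open ≡-Reasoning

NormalForm-cong : ∀ {z z′ q q′ fs fs′} → z ≡ z′ → q ≡ q′ → fs ≡ fs′ → NormalForm z q fs ≗ₛ NormalForm z′ q′ fs′
NormalForm-cong refl refl refl N m = refl

lastUnitShape-normal : ∀ n → shapeSeries (lastUnitShape n) ≗ₛ NormalForm n (gDegree (suc n) + 2) (gFactors (suc n))
lastUnitShape-normal n N m = trans (shapeSeries-normal (lastUnitShape n) N m) (NormalForm-cong z≡ q≡ fs≡ N m)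
  where
  z≡ : zShift (shapeSlots 0 (lastUnitShape n)) ≡ n
  z≡ = trans (zShift-zeroUnits (lastOneUnit ∷ []) finalPair 0 n) (ℕ.+-identityʳ n)
  q≡ : qShift (shapeSlots 0 (lastUnitShape n)) ≡ gDegree (suc n) + 2
  q≡ rewrite qShift-zeroUnits (lastOneUnit ∷ []) finalPair 0 n | offset-≡ 0 n = ℕ-Solver.solve [ n ]
  fs≡ : openFactors (shapeSlots 0 (lastUnitShape n)) ≡ gFactors (suc n)
  fs≡ = trans (openFactors-zeroUnits (lastOneUnit ∷ []) finalPair 0 n) (sym (gFactors-suc n))

lastUnitShape₀-normal : ∀ n → shapeSeries (lastUnitShape₀ n) ≗ₛ NormalForm (suc n) (gDegree (suc n) + 3) (hFactors n)
lastUnitShape₀-normal n N m = trans (shapeSeries-normal (lastUnitShape₀ n) N m) (NormalForm-cong z≡ q≡ fs≡ N m)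
  where
  z≡ : zShift (shapeSlots 0 (lastUnitShape₀ n)) ≡ suc n
  z≡ = trans (zShift-zeroUnits (lastOneUnit₀ ∷ []) finalPair⁺ 0 n) (ℕ.+-comm n 1)
  q≡ : qShift (shapeSlots 0 (lastUnitShape₀ n)) ≡ gDegree (suc n) + 3
  q≡ rewrite qShift-zeroUnits (lastOneUnit₀ ∷ []) finalPair⁺ 0 n | offset-≡ 0 n = ℕ-Solver.solve [ n ]
  fs≡ : openFactors (shapeSlots 0 (lastUnitShape₀ n)) ≡ hFactors n
  fs≡ = trans (openFactors-zeroUnits (lastOneUnit₀ ∷ []) finalPair⁺ 0 n)
              (cong (λ o → unitFactors 0 n ++ (+ 1 , suc (offset 0 n)) ∷ (+ 1 , suc o) ∷ []) (sym (offset-suc 0 n)))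

oneUnitAt-normal : ∀ i r → shapeSeries (oneUnitAt i r) ≗ₛ NormalForm (i + r) (qShift (shapeSlots 0 (oneUnitAt i r))) (gFactors (i + suc r))
oneUnitAt-normal i r N m = trans (shapeSeries-normal (oneUnitAt i r) N m) (NormalForm-cong {q = qShift (shapeSlots 0 (oneUnitAt i r))} z≡ refl fs≡ N m)
  where
  K = offset 0 i
  zeroTail : ∀ k → shapeSlots k (replicate r zeroUnit , finalPair) ≡ shapeSlots k (replicate r zeroUnit ++ [] , finalPair)
  zeroTail k = cong (λ bs → shapeSlots k (bs , finalPair)) (sym (List.++-identityʳ (replicate r zeroUnit)))
  z≡ : zShift (shapeSlots 0 (oneUnitAt i r)) ≡ i + r
  z≡ = begin
    zShift (shapeSlots 0 (oneUnitAt i r))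
      ≡⟨ zShift-zeroUnits (oneUnit ∷ replicate r zeroUnit) finalPair 0 i ⟩
    i + zShift (shapeSlots (3 + K) (replicate r zeroUnit , finalPair))
      ≡⟨ cong (λ es → i + zShift es) (zeroTail (3 + K)) ⟩
    i + zShift (shapeSlots (3 + K) (replicate r zeroUnit ++ [] , finalPair))
      ≡⟨ cong (λ t → i + t) (trans (zShift-zeroUnits [] finalPair (3 + K) r) (ℕ.+-identityʳ r)) ⟩
    i + r ∎
    where open ≡-Reasoning
  fs≡ : openFactors (shapeSlots 0 (oneUnitAt i r)) ≡ gFactors (i + suc r)
  fs≡ = begin
    openFactors (shapeSlots 0 (oneUnitAt i r))
      ≡⟨ openFactors-zeroUnits (oneUnit ∷ replicate r zeroUnit) finalPair 0 i ⟩
    unitFactors 0 i ++ (+ 1 , suc K) ∷ (+ 0 , 3 + K) ∷ openFactors (shapeSlots (3 + K) (replicate r zeroUnit , finalPair))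
      ≡⟨ cong (λ es → unitFactors 0 i ++ (+ 1 , suc K) ∷ (+ 0 , 3 + K) ∷ openFactors es) (zeroTail (3 + K)) ⟩
    unitFactors 0 i ++ (+ 1 , suc K) ∷ (+ 0 , 3 + K) ∷ openFactors (shapeSlots (3 + K) (replicate r zeroUnit ++ [] , finalPair))
      ≡⟨ cong (λ fs → unitFactors 0 i ++ (+ 1 , suc K) ∷ (+ 0 , 3 + K) ∷ fs) (openFactors-zeroUnits [] finalPair (3 + K) r) ⟩
    unitFactors 0 i ++ (unitFactors K (suc r) ++ (+ 1 , suc (offset K (suc r))) ∷ [])
      ≡⟨ sym (List.++-assoc (unitFactors 0 i) _ _) ⟩
    (unitFactors 0 i ++ unitFactors K (suc r)) ++ (+ 1 , suc (offset K (suc r))) ∷ []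
      ≡⟨ sym (cong₂ (λ us o → us ++ (+ 1 , suc o) ∷ []) (unitFactors-+ 0 i (suc r)) (offset-+ 0 i (suc r))) ⟩
    gFactors (i + suc r) ∎
    where open ≡-Reasoning

qShift-oneUnitAt : ∀ i r → qShift (shapeSlots 0 (oneUnitAt i r)) + (3 * i + 1) ≡ gDegree (i + suc r)
qShift-oneUnitAt i r
  rewrite qShift-zeroUnits (oneUnit ∷ replicate r zeroUnit) finalPair 0 i
        | sym (List.++-identityʳ (replicate r zeroUnit))
        | qShift-zeroUnits [] finalPair (suc (suc (suc (offset 0 i)))) r
        | offset-≡ (suc (suc (suc (offset 0 i)))) r | offset-≡ 0 i
        = ℕ-Solver.solve (List ℕ ∋ i ∷ r ∷ [])

pochFactors : ℤ → ℕ → ℕ → ℕ → List Factor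
pochFactors a c b zero    = []
pochFactors a c b (suc k) = (a , c + b * k) ∷ pochFactors a c b k

divPoch-divFactors : ∀ a c b k s → divPoch a c b k s ≡ divFactors (pochFactors a c b k) s
divPoch-divFactors a c b zero    s = refl
divPoch-divFactors a c b (suc k) s = cong (divFactor a (c + b * k)) (divPoch-divFactors a c b k s)

pochFactors-positive : ∀ a c b k → 1 ≤ c → All PositiveDegree (pochFactors a c b k)
pochFactors-positive a c b zero    _   = []
pochFactors-positive a c b (suc k) 1≤c = ℕ.≤-trans 1≤c (ℕ.m≤m+n c (b * k)) ∷ pochFactors-positive a c b k 1≤c

-- The two interleaved halves of unitFactors k n: (q^{k+3} ; q³)_n and (z q^{k+1} ; q³)_n.
qFactors zqFactors : ℕ → ℕ → List Factor
qFactors  k zero    = []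
qFactors  k (suc n) = (+ 0 , suc (suc (suc k))) ∷ qFactors (suc (suc (suc k))) n
zqFactors k zero    = []
zqFactors k (suc n) = (+ 1 , suc k) ∷ zqFactors (suc (suc (suc k))) n

unitFactors-↭ : ∀ k n → unitFactors k n ↭ qFactors k n ++ zqFactors k n
unitFactors-↭ k zero    = ↭.refl
unitFactors-↭ k (suc n) =
  ↭.trans (↭.prep zq (↭.prep q (unitFactors-↭ k′ n)))
    (↭.trans (↭.swap zq q ↭.refl) (↭.prep q (↭.↭-sym (↭.shift zq (qFactors k′ n) (zqFactors k′ n)))))
  where
  k′ = suc (suc (suc k))
  zq = (+ 1 , suc k)
  q  = (+ 0 , k′)

qFactors-∷ʳ : ∀ k n → qFactors k (suc n) ≡ qFactors k n ∷ʳ (+ 0 , 3 + offset k n)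
qFactors-∷ʳ k zero    = refl
qFactors-∷ʳ k (suc n) = cong ((+ 0 , suc (suc (suc k))) ∷_) (qFactors-∷ʳ (suc (suc (suc k))) n)

zqFactors-∷ʳ : ∀ k n → zqFactors k (suc n) ≡ zqFactors k n ∷ʳ (+ 1 , suc (offset k n))
zqFactors-∷ʳ k zero    = refl
zqFactors-∷ʳ k (suc n) = cong ((+ 1 , suc k) ∷_) (zqFactors-∷ʳ (suc (suc (suc k))) n)

pochFactors-q-↭ : ∀ n → pochFactors (+ 0) 3 3 n ↭ qFactors 0 n
pochFactors-q-↭ zero    = ↭.refl
pochFactors-q-↭ (suc n) =
  ↭.trans (↭.prep _ (pochFactors-q-↭ n))
    (↭.trans (↭.∷↭∷ʳ _ (qFactors 0 n))
      (↭.↭-reflexive (trans (cong (λ o → qFactors 0 n ∷ʳ (+ 0 , 3 + o)) (sym (offset-≡ 0 n))) (sym (qFactors-∷ʳ 0 n)))))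

pochFactors-zq-↭ : ∀ n → pochFactors (+ 1) 1 3 n ↭ zqFactors 0 n
pochFactors-zq-↭ zero    = ↭.refl
pochFactors-zq-↭ (suc n) =
  ↭.trans (↭.prep _ (pochFactors-zq-↭ n))
    (↭.trans (↭.∷↭∷ʳ _ (zqFactors 0 n))
      (↭.↭-reflexive (trans (cong (λ o → zqFactors 0 n ∷ʳ (+ 1 , suc o)) (sym (offset-≡ 0 n))) (sym (zqFactors-∷ʳ 0 n)))))

gPochFactors hPochFactors : ℕ → List Factor
gPochFactors n = pochFactors (+ 0) 3 3 n ++ pochFactors (+ 1) 1 3 (suc n)
hPochFactors n = pochFactors (+ 0) 3 3 n ++ pochFactors (+ 1) 1 3 (suc (suc n))

gPochFactors-↭ : ∀ n → gPochFactors n ↭ gFactors n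
gPochFactors-↭ n =
  ↭.trans (↭.++⁺ (pochFactors-q-↭ n) (pochFactors-zq-↭ (suc n)))
    (↭.trans (↭.↭-reflexive (trans (cong (qFactors 0 n ++_) (zqFactors-∷ʳ 0 n))
                                    (sym (List.++-assoc (qFactors 0 n) (zqFactors 0 n) _))))
      (↭.++⁺ʳ _ (↭.↭-sym (unitFactors-↭ 0 n))))

hPochFactors-↭ : ∀ n → hPochFactors n ↭ hFactors n
hPochFactors-↭ n =
  ↭.trans (↭.++⁺ (pochFactors-q-↭ n) (pochFactors-zq-↭ (suc (suc n))))
    (↭.trans (↭.↭-reflexive split) (↭.++⁺ʳ _ (↭.↭-sym (unitFactors-↭ 0 n))))
  where
  split : qFactors 0 n ++ zqFactors 0 (suc (suc n))
          ≡ (qFactors 0 n ++ zqFactors 0 n) ++ (+ 1 , suc (offset 0 n)) ∷ (+ 1 , suc (offset 0 (suc n))) ∷ []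
  split = begin
    qFactors 0 n ++ zqFactors 0 (suc (suc n))
      ≡⟨ cong (qFactors 0 n ++_) (trans (zqFactors-∷ʳ 0 (suc n)) (cong (_∷ʳ (+ 1 , suc (offset 0 (suc n)))) (zqFactors-∷ʳ 0 n))) ⟩
    qFactors 0 n ++ ((zqFactors 0 n ∷ʳ (+ 1 , suc (offset 0 n))) ∷ʳ (+ 1 , suc (offset 0 (suc n))))
      ≡⟨ cong (qFactors 0 n ++_) (List.++-assoc (zqFactors 0 n) _ _) ⟩
    qFactors 0 n ++ (zqFactors 0 n ++ (+ 1 , suc (offset 0 n)) ∷ (+ 1 , suc (offset 0 (suc n))) ∷ [])
      ≡⟨ sym (List.++-assoc (qFactors 0 n) (zqFactors 0 n) _) ⟩
    (qFactors 0 n ++ zqFactors 0 n) ++ (+ 1 , suc (offset 0 n)) ∷ (+ 1 , suc (offset 0 (suc n))) ∷ [] ∎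
    where open ≡-Reasoning

gPochFactors-positive : ∀ n → All PositiveDegree (gPochFactors n)
gPochFactors-positive n = All.++⁺ (pochFactors-positive (+ 0) 3 3 n (s≤s z≤n)) (pochFactors-positive (+ 1) 1 3 (suc n) (s≤s z≤n))

hPochFactors-positive : ∀ n → All PositiveDegree (hPochFactors n)
hPochFactors-positive n =
  All.++⁺ (pochFactors-positive (+ 0) 3 3 n (s≤s z≤n)) (pochFactors-positive (+ 1) 1 3 (suc (suc n)) (s≤s z≤n))

G-normal : ∀ n → G n ≗ₛ NormalForm (suc n) (gDegree n) (gFactors n)
G-normal n N m = begin
  G n N m
    ≡⟨ cong (λ s → s N m) G≡ ⟩
  divFactors (gPochFactors n) (mulMono (+ suc n) (gDegree n) one) N m
    ≡⟨ divFactors-mulMono (gPochFactors n) (+ suc n) (gDegree n) one (gPochFactors-positive n) N m ⟩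
  mulMono (+ suc n) (gDegree n) (divFactors (gPochFactors n) one) N m
    ≡⟨ mulMono-cong (+ suc n) (gDegree n) (divFactors-↭ (gPochFactors-↭ n) (gPochFactors-positive n) one) N m ⟩
  NormalForm (suc n) (gDegree n) (gFactors n) N m ∎
  where
  open ≡-Reasoning
  G≡ : G n ≡ divFactors (gPochFactors n) (mulMono (+ suc n) (gDegree n) one)
  G≡ = trans (divPoch-divFactors (+ 0) 3 3 n _)
         (trans (cong (divFactors (pochFactors (+ 0) 3 3 n)) (divPoch-divFactors (+ 1) 1 3 (suc n) _))
           (sym (divFactors-++ (pochFactors (+ 0) 3 3 n) (pochFactors (+ 1) 1 3 (suc n)) _)))

-- G_{n+1} without its factor 1/(1 − q^{3n+3}).
H : ℕ → Series
H n = divFactors (hPochFactors n) (mulMono (+ suc (suc n)) (gDegree (suc n)) one)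

G-suc≡H : ∀ n → G (suc n) ≡ divFactor (+ 0) (3 + 3 * n) (H n)
G-suc≡H n = cong (divFactor (+ 0) (3 + 3 * n))
  (trans (divPoch-divFactors (+ 0) 3 3 n _)
    (trans (cong (divFactors (pochFactors (+ 0) 3 3 n)) (divPoch-divFactors (+ 1) 1 3 (suc (suc n)) _))
      (sym (divFactors-++ (pochFactors (+ 0) 3 3 n) (pochFactors (+ 1) 1 3 (suc (suc n))) _))))

H-normal : ∀ n → H n ≗ₛ NormalForm (suc (suc n)) (gDegree (suc n)) (hFactors n)
H-normal n N m =
  trans (divFactors-mulMono (hPochFactors n) (+ suc (suc n)) (gDegree (suc n)) one (hPochFactors-positive n) N m)
        (mulMono-cong (+ suc (suc n)) (gDegree (suc n)) (divFactors-↭ (hPochFactors-↭ n) (hPochFactors-positive n) one) N m)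

-- The right-hand side

at-cong : ∀ {s t} → s ≗ₛ t → ∀ X m → at s X m ≡ at t X m
at-cong s≗t (+ N)    m = s≗t N m
at-cong s≗t -[1+ _ ] m = refl

at-mulMono : ∀ a b s X m → at (mulMono a b s) X m ≡ at s (X ℤ.- + b) (m ℤ.- a)
at-mulMono a zero    s -[1+ _ ] m = refl
at-mulMono a (suc b) s -[1+ _ ] m = refl
at-mulMono a b       s (+ N)    m with b ≤? N
... | yes b≤N rewrite dec-true (b ≤? N) b≤N | ℤ.m-n≡m⊖n N b | ℤ.⊖-≥ b≤N = refl
... | no  b≰N rewrite dec-false (b ≤? N) b≰N | ℤ.m-n≡m⊖n N b | ℤ.⊖-< (ℕ.≰⇒> b≰N) =
  sym (at-negative (b ∸ N) (ℕ.m<n⇒0<n∸m (ℕ.≰⇒> b≰N)))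
  where
  at-negative : ∀ k → 0 < k → at s (ℤ.- + k) (m ℤ.- a) ≡ + 0
  at-negative (suc k) _ = refl

at-mulMono-shift : ∀ a b a′ b′ s X m (c d : ℤ) → + b′ ≡ + b ℤ.+ d → a′ ≡ a ℤ.+ c →
  at (mulMono a b s) (X ℤ.- d) (m ℤ.- c) ≡ at (mulMono a′ b′ s) X m
at-mulMono-shift a b a′ b′ s X m c d b′≡ a′≡ = begin
  at (mulMono a b s) (X ℤ.- d) (m ℤ.- c)  ≡⟨ at-mulMono a b s (X ℤ.- d) (m ℤ.- c) ⟩
  at s (X ℤ.- d ℤ.- + b) (m ℤ.- c ℤ.- a)  ≡⟨ cong₂ (at s) (trans (sub-sub-comm X d (+ b)) (cong (λ t → X ℤ.- t) (sym b′≡)))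
                                                         (trans (sub-sub-comm m c a) (cong (λ t → m ℤ.- t) (sym a′≡))) ⟩
  at s (X ℤ.- + b′) (m ℤ.- a′)            ≡⟨ sym (at-mulMono a′ b′ s X m) ⟩
  at (mulMono a′ b′ s) X m                ∎
  where
  open ≡-Reasoning
  sub-sub-comm : ∀ x y z → x ℤ.- y ℤ.- z ≡ x ℤ.- (z ℤ.+ y)
  sub-sub-comm = ℤ-Solver.solve-∀

G-H : ∀ n X m → at (G (suc n)) X m ℤ.+ ℤ.- + 1 ℤ.* at (G (suc n)) (X ℤ.- + (3 + 3 * n)) m ≡ at (H n) X m
G-H n -[1+ _ ] m = refl
G-H n (+ N)    m = begin
  G (suc n) N m ℤ.+ ℤ.- + 1 ℤ.* at (G (suc n)) (+ N ℤ.- + c) m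
    ≡⟨ cong₂ (λ x y → x ℤ.+ ℤ.- + 1 ℤ.* y) (cong (λ s → s N m) (G-suc≡H n)) shifted ⟩
  divFactor (+ 0) c (H n) N m ℤ.+ ℤ.- + 1 ℤ.* shiftedH
    ≡⟨ cong (λ x → x ℤ.+ ℤ.- + 1 ℤ.* shiftedH) (divFactor-unfold (+ 0) c (H n) (s≤s z≤n) N m) ⟩
  H n N m ℤ.+ shiftedH ℤ.+ ℤ.- + 1 ℤ.* shiftedH
    ≡⟨ cancel (H n N m) shiftedH ⟩
  H n N m ∎
  where
  open ≡-Reasoning
  c = 3 + 3 * n
  shiftedH = mulMono (+ 0) c (divFactor (+ 0) c (H n)) N m
  shifted : at (G (suc n)) (+ N ℤ.- + c) m ≡ shiftedH
  shifted = begin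
    at (G (suc n)) (+ N ℤ.- + c) m           ≡⟨ cong (at (G (suc n)) (+ N ℤ.- + c)) (sym (ℤ.+-identityʳ m)) ⟩
    at (G (suc n)) (+ N ℤ.- + c) (m ℤ.- + 0) ≡⟨ sym (at-mulMono (+ 0) c (G (suc n)) (+ N) m) ⟩
    mulMono (+ 0) c (G (suc n)) N m          ≡⟨ cong (λ s → mulMono (+ 0) c s N m) (G-suc≡H n) ⟩
    shiftedH                                 ∎
  cancel : ∀ x y → x ℤ.+ y ℤ.+ ℤ.- + 1 ℤ.* y ≡ x
  cancel = ℤ-Solver.solve-∀

at-lastUnitShape : ∀ n X m →
  + 1 ℤ.* at (G (suc n)) (X ℤ.- + 2) (m ℤ.- ℤ.- + 2) ≡ at (shapeSeries (lastUnitShape n)) X m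
at-lastUnitShape n X m = begin
  + 1 ℤ.* at (G (suc n)) (X ℤ.- + 2) (m ℤ.- ℤ.- + 2)
    ≡⟨ ℤ.*-identityˡ _ ⟩
  at (G (suc n)) (X ℤ.- + 2) (m ℤ.- ℤ.- + 2)
    ≡⟨ at-cong (G-normal (suc n)) (X ℤ.- + 2) (m ℤ.- ℤ.- + 2) ⟩
  at (NormalForm (suc (suc n)) (gDegree (suc n)) (gFactors (suc n))) (X ℤ.- + 2) (m ℤ.- ℤ.- + 2)
    ≡⟨ at-mulMono-shift _ _ _ _ (divFactors (gFactors (suc n)) one) X m (ℤ.- + 2) (+ 2)
         (ℤ.pos-+ (gDegree (suc n)) 2) (sym (+[m+n]-+m≡+n 2 n)) ⟩
  at (NormalForm n (gDegree (suc n) + 2) (gFactors (suc n))) X m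
    ≡⟨ sym (at-cong (lastUnitShape-normal n) X m) ⟩
  at (shapeSeries (lastUnitShape n)) X m ∎
  where open ≡-Reasoning

at-lastUnitShape₀ : ∀ n X m →
  + 1 ℤ.* at (G (suc n)) (X ℤ.- + 3) (m ℤ.- ℤ.- + 1) ℤ.+ ℤ.- + 1 ℤ.* at (G (suc n)) (X ℤ.- (+ 3 ℤ.+ + (3 * suc n))) (m ℤ.- ℤ.- + 1)
    ≡ at (shapeSeries (lastUnitShape₀ n)) X m
at-lastUnitShape₀ n X m = begin
  + 1 ℤ.* at (G (suc n)) (X ℤ.- + 3) m′ ℤ.+ ℤ.- + 1 ℤ.* at (G (suc n)) (X ℤ.- (+ 3 ℤ.+ + (3 * suc n))) m′
    ≡⟨ cong₂ (λ x y → x ℤ.+ ℤ.- + 1 ℤ.* at (G (suc n)) y m′) (ℤ.*-identityˡ (at (G (suc n)) (X ℤ.- + 3) m′)) X-shift ⟩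
  at (G (suc n)) (X ℤ.- + 3) m′ ℤ.+ ℤ.- + 1 ℤ.* at (G (suc n)) (X ℤ.- + 3 ℤ.- + (3 + 3 * n)) m′
    ≡⟨ G-H n (X ℤ.- + 3) m′ ⟩
  at (H n) (X ℤ.- + 3) m′
    ≡⟨ at-cong (H-normal n) (X ℤ.- + 3) m′ ⟩
  at (NormalForm (suc (suc n)) (gDegree (suc n)) (hFactors n)) (X ℤ.- + 3) m′
    ≡⟨ at-mulMono-shift _ _ _ _ (divFactors (hFactors n) one) X m (ℤ.- + 1) (+ 3)
         (ℤ.pos-+ (gDegree (suc n)) 3) (sym (+[m+n]-+m≡+n 1 (suc n))) ⟩
  at (NormalForm (suc n) (gDegree (suc n) + 3) (hFactors n)) X m
    ≡⟨ sym (at-cong (lastUnitShape₀-normal n) X m) ⟩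
  at (shapeSeries (lastUnitShape₀ n)) X m ∎
  where
  open ≡-Reasoning
  m′ = m ℤ.- ℤ.- + 1
  X-shift : X ℤ.- (+ 3 ℤ.+ + (3 * suc n)) ≡ X ℤ.- + 3 ℤ.- + (3 + 3 * n)
  X-shift = trans (cong (λ k → X ℤ.- (+ 3 ℤ.+ + k)) (ℕ.*-suc 3 n)) (sym (m-n-o≡m-[n+o] X (+ 3) (+ (3 + 3 * n))))

innerShape : ℕ → ℕ → Shape
innerShape n t = oneUnitAt (n ∸ suc t) (suc t)

shapes-suc : ∀ n → shapes (suc n) ≡ lastUnitShape n ∷ lastUnitShape₀ n ∷ map (innerShape n) (upTo n)
shapes-suc zero    = refl
shapes-suc (suc n) rewrite shapes-suc n = cong (λ ss → lastUnitShape (suc n) ∷ lastUnitShape₀ (suc n) ∷ ss) inner≡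
  where
  inner≡ : map consZeroUnit (map (innerShape n) (upTo n)) ++ oneUnitShapes (suc n) ≡ map (innerShape (suc n)) (upTo (suc n))
  inner≡ = begin
    map consZeroUnit (map (innerShape n) (upTo n)) ++ oneUnitAt 0 (suc n) ∷ []
      ≡⟨ cong₂ (λ ss i → ss ++ oneUnitAt i (suc n) ∷ [])
           (trans (sym (List.map-∘ (upTo n))) (List.map-cong-local (All.map consZeroUnit-inner (All.all-upTo n))))
           (sym (ℕ.n∸n≡0 n)) ⟩
    map (innerShape (suc n)) (upTo n) ++ innerShape (suc n) n ∷ []
      ≡⟨ sym (List.map-++ (innerShape (suc n)) (upTo n) (n ∷ [])) ⟩
    map (innerShape (suc n)) (upTo n ∷ʳ n)
      ≡⟨ cong (map (innerShape (suc n))) (List.upTo-∷ʳ n) ⟩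
    map (innerShape (suc n)) (upTo (suc n)) ∎
    where
    open ≡-Reasoning
    consZeroUnit-inner : ∀ {t} → t < n → consZeroUnit (innerShape n t) ≡ innerShape (suc n) t
    consZeroUnit-inner {t} t<n = cong (λ i → oneUnitAt i (suc t)) (sym (ℕ.+-∸-assoc 1 t<n))

innerTerm : ℕ → ℕ → ℤ × ℤ × ℤ
innerTerm n d = (+ 1 , ℤ.- + 2 , ℤ.- (+ (3 * n) ℤ.- + (3 * d) ℤ.- + 2))

innerOffset : ∀ i t → ℤ.- (+ (3 * suc (i + suc t)) ℤ.- + (3 * suc t) ℤ.- + 2) ≡ ℤ.- + (3 * i + 1)
innerOffset i t = begin
  ℤ.- (+ (3 * suc (i + suc t)) ℤ.- + (3 * suc t) ℤ.- + 2)
    ≡⟨ cong (λ x → ℤ.- (x ℤ.- + (3 * suc t) ℤ.- + 2)) pos-split ⟩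
  ℤ.- (+ (3 * suc t) ℤ.+ + 2 ℤ.+ + (3 * i + 1) ℤ.- + (3 * suc t) ℤ.- + 2)
    ≡⟨ cancel (+ (3 * suc t)) (+ 2) (+ (3 * i + 1)) ⟩
  ℤ.- + (3 * i + 1) ∎
  where
  open ≡-Reasoning
  pos-split : + (3 * suc (i + suc t)) ≡ + (3 * suc t) ℤ.+ + 2 ℤ.+ + (3 * i + 1)
  pos-split rewrite sym (ℤ.pos-+ (3 * suc t) 2) | sym (ℤ.pos-+ (3 * suc t + 2) (3 * i + 1)) =
    cong +_ (ℕ-Solver.solve (List ℕ ∋ i ∷ t ∷ []))
  cancel : ∀ p q r → ℤ.- (p ℤ.+ q ℤ.+ r ℤ.- p ℤ.- q) ≡ ℤ.- r
  cancel = ℤ-Solver.solve-∀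

at-oneUnitAt : ∀ i t X m →
  + 1 ℤ.* at (G (suc (i + suc t))) (X ℤ.- ℤ.- (+ (3 * suc (i + suc t)) ℤ.- + (3 * suc t) ℤ.- + 2)) (m ℤ.- ℤ.- + 2)
    ≡ at (shapeSeries (oneUnitAt i (suc t))) X m
at-oneUnitAt i t X m = begin
  + 1 ℤ.* at (G (suc n)) (X ℤ.- b) (m ℤ.- ℤ.- + 2)
    ≡⟨ ℤ.*-identityˡ _ ⟩
  at (G (suc n)) (X ℤ.- b) (m ℤ.- ℤ.- + 2)
    ≡⟨ at-cong (G-normal (suc n)) (X ℤ.- b) (m ℤ.- ℤ.- + 2) ⟩
  at (NormalForm (suc (suc n)) (gDegree (suc n)) (gFactors (suc n))) (X ℤ.- b) (m ℤ.- ℤ.- + 2)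
    ≡⟨ at-mulMono-shift _ _ _ _ (divFactors (gFactors (suc n)) one) X m (ℤ.- + 2) b q≡ (sym (+[m+n]-+m≡+n 2 n)) ⟩
  at (NormalForm n q (gFactors (suc n))) X m
    ≡⟨ cong (λ k → at (NormalForm n q (gFactors k)) X m) (sym (ℕ.+-suc i (suc t))) ⟩
  at (NormalForm n q (gFactors (i + suc (suc t)))) X m
    ≡⟨ sym (at-cong (oneUnitAt-normal i (suc t)) X m) ⟩
  at (shapeSeries (oneUnitAt i (suc t))) X m ∎
  where
  open ≡-Reasoning
  n = i + suc t
  q = qShift (shapeSlots 0 (oneUnitAt i (suc t)))
  b = ℤ.- (+ (3 * suc n) ℤ.- + (3 * suc t) ℤ.- + 2)
  q≡ : + q ≡ + gDegree (suc n) ℤ.+ b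
  q≡ = begin
    + q                                     ≡⟨ sym (+[m+n]-+n≡+m q (3 * i + 1)) ⟩
    + (q + (3 * i + 1)) ℤ.- + (3 * i + 1)
      ≡⟨ cong₂ ℤ._+_ (cong +_ (trans (qShift-oneUnitAt i (suc t)) (cong gDegree (ℕ.+-suc i (suc t)))))
                     (sym (innerOffset i t)) ⟩
    + gDegree (suc n) ℤ.+ b                 ∎

mulL-innerTerms : ∀ n ts → All (_< n) ts → ∀ X m →
  mulL (map (innerTerm (suc n)) (map suc ts)) (G (suc n)) X m ≡ sumℤ (map (λ t → at (shapeSeries (innerShape n t)) X m) ts)
mulL-innerTerms n []       []         X m = refl
mulL-innerTerms n (t ∷ ts) (t<n ∷ ps) X m =
  cong₂ ℤ._+_ (subst (λ k → + 1 ℤ.* at (G (suc k)) (X ℤ.- ℤ.- (+ (3 * suc k) ℤ.- + (3 * suc t) ℤ.- + 2)) (m ℤ.- ℤ.- + 2)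
                          ≡ at (shapeSeries (innerShape n t)) X m)
                      (ℕ.m∸n+n≡m t<n) (at-oneUnitAt (n ∸ suc t) t X m))
              (mulL-innerTerms n ts ps X m)

shapeSum : ℕ → ℤ → ℤ → ℤ
shapeSum n X m = sumℤ (map (λ s → at (shapeSeries s) X m) (shapes (suc n)))

rhsCoef≡shapeSum : ∀ n X m → rhsCoef (suc n) X m ≡ shapeSum n X m
rhsCoef≡shapeSum n X m rewrite shapes-suc n =
  cong₂ ℤ._+_ (at-lastUnitShape n X m)
    (trans (sym (ℤ.+-assoc (+ 1 ℤ.* at (G (suc n)) (X ℤ.- + 3) (m ℤ.- ℤ.- + 1))
                            (ℤ.- + 1 ℤ.* at (G (suc n)) (X ℤ.- (+ 3 ℤ.+ + (3 * suc n))) (m ℤ.- ℤ.- + 1))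
                            (mulL (map (innerTerm (suc n)) (map suc (upTo n))) (G (suc n)) X m)))
           (cong₂ ℤ._+_ (at-lastUnitShape₀ n X m)
                         (trans (mulL-innerTerms n (upTo n) (All.all-upTo n) X m) (cong sumℤ (List.map-∘ (upTo n))))))

lhsCoef≡shapeSum : ∀ n X m → lhsCoef (length3n+2 (suc n)) X m ≡ shapeSum n X m
lhsCoef≡shapeSum n (+ N)    m = lhsCoef≡sum-shapeSeries (suc n) N m
lhsCoef≡shapeSum n -[1+ _ ] m = sym (sumℤ-zeros (shapes (suc n)))
  where
  sumℤ-zeros : ∀ (ss : List Shape) → sumℤ (map (λ _ → + 0) ss) ≡ + 0
  sumℤ-zeros []       = refl
  sumℤ-zeros (_ ∷ ss) = trans (ℤ.+-identityˡ _) (sumℤ-zeros ss)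

3n+2≡length3n+2 : ∀ n → 3 * n + 2 ≡ length3n+2 n
3n+2≡length3n+2 zero    = refl
3n+2≡length3n+2 (suc n) = trans (identity n) (cong (suc ∘ suc ∘ suc) (3n+2≡length3n+2 n))
  where
  identity : ∀ n → 3 * suc n + 2 ≡ suc (suc (suc (3 * n + 2)))
  identity = ℕ-Solver.solve-∀

lemma3p5 : (n : ℕ) → 1 ≤ n →
    (N m : ℤ) → lhsCoef (3 * n + 2) N m ≡ rhsCoef n N m
lemma3p5 (suc n) _ N m = begin
  lhsCoef (3 * suc n + 2) N m        ≡⟨ cong (λ L → lhsCoef L N m) (3n+2≡length3n+2 (suc n)) ⟩
  lhsCoef (length3n+2 (suc n)) N m   ≡⟨ lhsCoef≡shapeSum n N m ⟩
  shapeSum n N m                     ≡⟨ sym (rhsCoef≡shapeSum n N m) ⟩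
  rhsCoef (suc n) N m                ∎
  where open ≡-Reasoning
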